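{- Let $n\ge 11$ and $1\le d\le n-1$ be integers, $T_{n,d}=\frac{n(n+1)}{2}-d$, and $\pi_{n,d}=(1,2,\dots,d-1,d+1,\dots,n)$. For a partition $\lambda$ of $T_{n,d}$ into distinct parts, let $h$ be the number of parts of $\pi_{n,d}$ that are not parts of $\lambda$ and $j$ the number of parts of $\lambda$ that are not parts of $\pi_{n,d}$. Consider $\lambda=(\lambda_1,\dots,\lambda_t)\in\mathbb U^*_{T_{n,d}}$ with $\lambda_t=2n-5$ and $d$ a part of $\lambda$. (i) If $h=j$, then $d=4$, $n$ is even, and there is exactly one such partition. (ii) For each integer $k$ with $1\le k\le\lfloor (n-4)/2\rfloor$ there exists such a $\lambda\in\mathbb U^*_{T_{n,d}}$ with $h=j+1$ and $d=n-2k$.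
   Context: A partition of $N$ into distinct parts is a sequence of positive integers $\lambda_1<\dots<\lambda_t$ summing to $N$ with $t\ge 2$. Its missing parts are the elements of $\{1,\dots,\lambda_t\}\setminus\{\lambda_1,\dots,\lambda_t\}$. $\lambda$ is refinable if two distinct missing parts sum to a part of $\lambda$, unrefinable otherwise; $\mathbb U_N$ is the set of unrefinable partitions of $N$. $\mathbb U^*_N$ is the set of $\lambda\in\mathbb U_N$ whose largest part is the maximum of the largest parts over all of $\mathbb U_N$. Standing assumption: $n\ge 11$. -}

module Defs where

open import Data.Nat using (ℕ; zero; suc; _+_; _*_; _∸_; _≤_; _<_; _⊔_)
open import Data.Nat.Properties using (_≟_)
open import Data.Nat.DivMod using (_/_)
open import Data.List using (List; []; _∷_; length; filter; applyUpTo; foldr)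
open import Data.Nat.ListAction using (sum)
open import Data.List.Relation.Unary.All using (All)
open import Data.List.Relation.Unary.Linked using (Linked)
open import Data.List.Membership.Propositional using (_∈_; _∉_)
open import Data.List.Membership.DecPropositional _≟_ using (_∈?_)
open import Data.Product using (Σ; ∃; _×_)
open import Relation.Nullary using (¬_; ¬?)
open import Relation.Binary.PropositionalEquality using (_≡_; _≢_)

record DistinctPartition (N : ℕ) (ps : List ℕ) : Set where
  field
    increasing : Linked _<_ ps
    positive   : All (λ x → 0 < x) ps
    atLeastTwo : 2 ≤ length ps
    sums       : sum ps ≡ N

-- Largest part (for a strictly increasing list this is its last element λₜ).
largest : List ℕ → ℕ
largest = foldr _⊔_ 0

Missing : ℕ → List ℕ → Set
Missing m ps = (1 ≤ m) × (m ≤ largest ps) × (m ∉ ps)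

Refinable : List ℕ → Set
Refinable ps = ∃ λ a → ∃ λ b → (a ≢ b) × Missing a ps × Missing b ps × ((a + b) ∈ ps)

Unrefinable : List ℕ → Set
Unrefinable ps = ¬ Refinable ps

U : ℕ → List ℕ → Set
U N ps = DistinctPartition N ps × Unrefinable ps

UStar : ℕ → List ℕ → Set
UStar N ps = U N ps × (∀ qs → U N qs → largest qs ≤ largest ps)

T : ℕ → ℕ → ℕ
T n d = (n * suc n) / 2 ∸ d

π : ℕ → ℕ → List ℕ
π n d = filter (λ x → ¬? (x ≟ d)) (applyUpTo suc n)

h : ℕ → ℕ → List ℕ → ℕ
h n d ps = length (filter (λ x → ¬? (x ∈? ps)) (π n d))

j : ℕ → ℕ → List ℕ → ℕ
j n d ps = length (filter (λ x → ¬? (x ∈? π n d)) ps)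

Such : ℕ → ℕ → List ℕ → Set
Such n d ps = UStar (T n d) ps × (largest ps ≡ 2 * n ∸ 5) × (d ∈ ps)

-- Write n = s + 3, so that 2n - 5 = 2s + 1 and T_{n,d} + d = 1 + 2 + ⋯ + (s + 3).  If λ ∈ 𝕌_N has largest
-- part m, then for every a < m/2 one of a, m - a is a part of λ; summing over these pairs gives
-- N ≥ (1 + ⋯ + s) + m for m ∈ {2s+1, 2s+2}.  Hence for d ≥ 3 every λ ∈ 𝕌_{T_{n,d}} has largest part at
-- most 2s + 2, and 2s + 2 is excluded by parity when d ≥ 4 and d ≡ n (mod 2).
--
-- (i) h = j forces λ to have n - 1 = s + 2 parts, so exactly one pair {a, 2s+1-a} is covered twice.
-- Weighing the pairs then gives d ≤ 4, with equality only for λ = (1, 2, …, s+1, 2s+1).  Maximality rules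
-- out d ≤ 3, since (1, …, s+1, 2s+5-d) has a larger largest part, and it rules out odd n = 2r + 5, since
-- {1, …, 2r+2} ∖ {r+2} ∪ {3r+4, 4r+6} does.
--
-- (ii) For k = u + v and s = u + v + g + 1 with u ≠ v, u, v < g and k ≤ g, the partition
-- {1, …, s} ∖ {v+g+1, u+g+1} ∪ {s+u+1, s+v+1, 2s+1} of T_{n,n-2k} is unrefinable, has s + 1 parts
-- (so h = j + 1), and is maximal by the bound above.

module Submission where

open import Defs
open import Data.Nat using (ℕ; suc; _*_; _∸_; _≤_)
open import Data.Nat.DivMod using (_/_)
open import Data.Nat.Divisibility using (_∣_)
open import Data.List using (List)
open import Data.Product using (∃; _×_)
open import Relation.Binary.PropositionalEquality using (_≡_)

open import Data.Nat
open import Data.Nat.Properties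
open import Data.Nat.DivMod using (m*n/n≡m; m/n*n≤m)
open import Data.Nat.Divisibility using (divides)
open import Data.Nat.ListAction using (sum)
open import Data.Nat.Tactic.RingSolver using (solve-∀)
open import Algebra.Properties.CommutativeSemigroup +-commutativeSemigroup
  using (interchange; xy∙z≈xz∙y; x∙yz≈xz∙y; x∙yz≈y∙xz)
open import Data.List using ([]; _∷_; length; filter; applyUpTo; map)
open import Data.List.Properties using (map-id)
open import Data.List.Relation.Unary.All as All using (All; []; _∷_)
open import Data.List.Relation.Unary.Any using (here; there)
open import Data.List.Relation.Unary.Linked as Linked using (Linked; _∷_)
open import Data.List.Relation.Unary.Linked.Properties using (applyUpTo⁺₂; filter⁺)
open import Data.List.Membership.Propositional using (_∈_; _∉_)
open import Data.List.Relation.Unary.Unique.Propositional using (Unique)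
open import Data.List.Relation.Unary.AllPairs using ([]; _∷_)
open import Data.List.Membership.Propositional.Properties
  using (∈-filter⁺; ∈-filter⁻; ∈-applyUpTo⁺; ∈-applyUpTo⁻)
open import Data.List.Membership.DecPropositional _≟_ using (_∈?_)
open import Data.Product using (_,_; proj₁; proj₂)
open import Data.Sum using (_⊎_; inj₁; inj₂; [_,_]′)
open import Data.Empty using (⊥-elim)
open import Function using (_∘_; _⟨_⟩_)
open import Relation.Nullary
open import Relation.Nullary.Decidable using (_×-dec_; _⊎-dec_; toSum)
open import Relation.Unary using (Pred; Decidable)
open import Relation.Binary.Definitions using (tri<; tri≈; tri>)
open import Relation.Binary.PropositionalEquality
open ≤-Reasoning

∑ : ℕ → (ℕ → ℕ) → ℕ
∑ zero    f = 0
∑ (suc n) f = ∑ n f + f (suc n)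

∑-cong : ∀ n {f g : ℕ → ℕ} → (∀ x → 1 ≤ x → x ≤ n → f x ≡ g x) → ∑ n f ≡ ∑ n g
∑-cong zero    f≡g = refl
∑-cong (suc n) f≡g =
  cong₂ _+_ (∑-cong n (λ x 1≤x x≤n → f≡g x 1≤x (m≤n⇒m≤1+n x≤n))) (f≡g (suc n) z<s ≤-refl)

∑-mono-≤ : ∀ n {f g : ℕ → ℕ} → (∀ x → 1 ≤ x → x ≤ n → f x ≤ g x) → ∑ n f ≤ ∑ n g
∑-mono-≤ zero    f≤g = z≤n
∑-mono-≤ (suc n) f≤g =
  +-mono-≤ (∑-mono-≤ n (λ x 1≤x x≤n → f≤g x 1≤x (m≤n⇒m≤1+n x≤n))) (f≤g (suc n) z<s ≤-refl)

∑-distrib-+ : ∀ n (f g : ℕ → ℕ) → ∑ n (λ x → f x + g x) ≡ ∑ n f + ∑ n g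
∑-distrib-+ zero    f g = refl
∑-distrib-+ (suc n) f g = begin-equality
  ∑ n (λ x → f x + g x) + (f (suc n) + g (suc n)) ≡⟨ cong (_+ (f (suc n) + g (suc n))) (∑-distrib-+ n f g) ⟩
  ∑ n f + ∑ n g + (f (suc n) + g (suc n))         ≡⟨ interchange (∑ n f) (∑ n g) (f (suc n)) (g (suc n)) ⟩
  ∑ n f + f (suc n) + (∑ n g + g (suc n))         ∎

∑-distribˡ-* : ∀ n k (f : ℕ → ℕ) → ∑ n (λ x → k * f x) ≡ k * ∑ n f
∑-distribˡ-* zero    k f = sym (*-zeroʳ k)
∑-distribˡ-* (suc n) k f =
  trans (cong (_+ k * f (suc n)) (∑-distribˡ-* n k f)) (sym (*-distribˡ-+ k (∑ n f) (f (suc n))))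

∑-const : ∀ n k → ∑ n (λ _ → k) ≡ n * k
∑-const zero    k = refl
∑-const (suc n) k = trans (cong (_+ k) (∑-const n k)) (+-comm (n * k) k)

∑-shift : ∀ n (f : ℕ → ℕ) → ∑ (suc n) f ≡ f 1 + ∑ n (λ x → f (suc x))
∑-shift zero    f = +-comm 0 (f 1)
∑-shift (suc n) f = trans (cong (_+ f (suc (suc n))) (∑-shift n f)) (+-assoc (f 1) _ _)

∑-split : ∀ p q (f : ℕ → ℕ) → ∑ (p + q) f ≡ ∑ p f + ∑ q (λ x → f (p + x))
∑-split p zero    f = trans (cong (λ z → ∑ z f) (+-identityʳ p)) (sym (+-identityʳ _))
∑-split p (suc q) f = begin-equality
  ∑ (p + suc q) f                                ≡⟨ cong (λ z → ∑ z f) (+-suc p q) ⟩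
  ∑ (p + q) f + f (suc (p + q))                  ≡⟨ cong₂ _+_ (∑-split p q f) (cong f (sym (+-suc p q))) ⟩
  ∑ p f + ∑ q (λ x → f (p + x)) + f (p + suc q)  ≡⟨ +-assoc (∑ p f) _ _ ⟩
  ∑ p f + ∑ (suc q) (λ x → f (p + x))            ∎

∑-reverse : ∀ n (f : ℕ → ℕ) → ∑ n f ≡ ∑ n (λ x → f (suc n ∸ x))
∑-reverse zero    f = refl
∑-reverse (suc n) f = begin-equality
  ∑ n f + f (suc n)                         ≡⟨ cong (_+ f (suc n)) (∑-reverse n f) ⟩
  ∑ n (λ x → f (suc n ∸ x)) + f (suc n)     ≡⟨ +-comm _ (f (suc n)) ⟩
  f (suc n) + ∑ n (λ x → f (suc n ∸ x))     ≡⟨ sym (∑-shift n (λ x → f (suc (suc n) ∸ x))) ⟩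
  ∑ (suc n) (λ x → f (suc (suc n) ∸ x))     ∎

∑-truncate : ∀ K n (f : ℕ → ℕ) → K ≤ n → (∀ x → K < x → f x ≡ 0) → ∑ n f ≡ ∑ K f
∑-truncate K zero    f z≤n  f≡0 = refl
∑-truncate K (suc n) f K≤1+n f≡0 with K ≟ suc n
... | yes refl = refl
... | no  K≢1+n = trans (cong₂ _+_ (∑-truncate K n f (≤-pred K<1+n) f≡0) (f≡0 (suc n) K<1+n)) (+-identityʳ _)
  where K<1+n = ≤∧≢⇒< K≤1+n K≢1+n

+-squeeze : ∀ a b c d → a + b ≡ c + d → c ≤ a → d ≤ b → (a ≡ c) × (b ≡ d)
+-squeeze a b c d eq c≤a d≤b = a≡c , +-cancelˡ-≡ a b d (trans eq (cong (_+ d) (sym a≡c)))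
  where
  a≡c : a ≡ c
  a≡c = ≤-antisym (+-cancelʳ-≤ b a c (≤-trans (≤-reflexive eq) (+-monoʳ-≤ c d≤b))) c≤a

∑-squeeze : ∀ n (f g : ℕ → ℕ) → (∀ x → 1 ≤ x → x ≤ n → g x ≤ f x) → ∑ n f ≡ ∑ n g →
            ∀ x → 1 ≤ x → x ≤ n → f x ≡ g x
∑-squeeze zero    f g g≤f eq x 1≤x x≤0 = ⊥-elim (<⇒≱ 1≤x x≤0)
∑-squeeze (suc n) f g g≤f eq x 1≤x x≤1+n
  with +-squeeze _ _ _ _ eq (∑-mono-≤ n (λ y p q → g≤f y p (m≤n⇒m≤1+n q))) (g≤f (suc n) z<s ≤-refl)
... | init≡ , last≡ with x ≟ suc n
...   | yes refl = last≡
...   | no  x≢1+n = ∑-squeeze n f g (λ y p q → g≤f y p (m≤n⇒m≤1+n q)) init≡ x 1≤x (≤-pred (≤∧≢⇒< x≤1+n x≢1+n))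

𝟙 : ∀ {p} {P : Set p} → Dec P → ℕ
𝟙 (yes _) = 1
𝟙 (no _)  = 0

𝟙-¬? : ∀ {p} {P : Set p} (P? : Dec P) → 𝟙 (¬? P?) + 𝟙 P? ≡ 1
𝟙-¬? (yes _) = refl
𝟙-¬? (no _)  = refl

𝟙-yes : ∀ {p} {P : Set p} (P? : Dec P) → P → 𝟙 P? ≡ 1
𝟙-yes (yes _) _ = refl
𝟙-yes (no ¬p) p = ⊥-elim (¬p p)

𝟙-no : ∀ {p} {P : Set p} (P? : Dec P) → ¬ P → 𝟙 P? ≡ 0
𝟙-no (yes p) ¬p = ⊥-elim (¬p p)
𝟙-no (no _)  _  = refl

𝟙-⇔ : ∀ {A B : Set} (A? : Dec A) (B? : Dec B) → (A → B) → (B → A) → 𝟙 A? ≡ 𝟙 B?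
𝟙-⇔ (yes _) (yes _) _ _ = refl
𝟙-⇔ (no _)  (no _)  _ _ = refl
𝟙-⇔ (yes a) (no ¬b) f _ = ⊥-elim (¬b (f a))
𝟙-⇔ (no ¬a) (yes b) _ g = ⊥-elim (¬a (g b))

∑-𝟙≟-beyond : ∀ n y (f : ℕ → ℕ) → n < y → ∑ n (λ x → 𝟙 (x ≟ y) * f x) ≡ 0
∑-𝟙≟-beyond zero    y f n<y = refl
∑-𝟙≟-beyond (suc n) y f n<y with suc n ≟ y
... | yes refl = ⊥-elim (<-irrefl refl n<y)
... | no  _    = trans (+-identityʳ _) (∑-𝟙≟-beyond n y f (<-trans (n<1+n n) n<y))

∑-𝟙≟ : ∀ n y (f : ℕ → ℕ) → 1 ≤ y → y ≤ n → ∑ n (λ x → 𝟙 (x ≟ y) * f x) ≡ f y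
∑-𝟙≟ zero    y f 1≤y y≤0 = ⊥-elim (<⇒≱ 1≤y y≤0)
∑-𝟙≟ (suc n) y f 1≤y y≤1+n with suc n ≟ y
... | yes refl = trans (cong (_+ (f (suc n) + 0)) (∑-𝟙≟-beyond n (suc n) f (n<1+n n))) (+-identityʳ _)
... | no  1+n≢y = trans (+-identityʳ _) (∑-𝟙≟ n y f 1≤y (≤-pred (≤∧≢⇒< y≤1+n (1+n≢y ∘ sym))))

∑-pair-odd : ∀ s (g : ℕ → ℕ) →
             ∑ (suc (s + s)) g ≡ ∑ s (λ a → g a + g (suc (s + s) ∸ a)) + g (suc (s + s))
∑-pair-odd s g = cong (_+ g (suc (s + s))) (begin-equality
  ∑ (s + s) g                                        ≡⟨ ∑-split s s g ⟩
  ∑ s g + ∑ s (λ x → g (s + x))                      ≡⟨ cong (∑ s g +_) (∑-reverse s (λ x → g (s + x))) ⟩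
  ∑ s g + ∑ s (λ x → g (s + (suc s ∸ x)))            ≡⟨ cong (∑ s g +_) (∑-cong s (λ x _ x≤s → cong g (reflect x x≤s))) ⟩
  ∑ s g + ∑ s (λ x → g (suc (s + s) ∸ x))            ≡⟨ sym (∑-distrib-+ s g _) ⟩
  ∑ s (λ a → g a + g (suc (s + s) ∸ a))              ∎)
  where
  reflect : ∀ x → x ≤ s → s + (suc s ∸ x) ≡ suc (s + s) ∸ x
  reflect x x≤s = trans (sym (+-∸-assoc s (m≤n⇒m≤1+n x≤s))) (cong (_∸ x) (+-suc s s))

∑-pair-even : ∀ s (g : ℕ → ℕ) →
              ∑ (suc (suc (s + s))) g ≡
              ∑ s (λ a → g a + g (suc (suc (s + s)) ∸ a)) + g (suc s) + g (suc (suc (s + s)))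
∑-pair-even s g = cong (_+ g (suc (suc (s + s)))) (begin-equality
  ∑ (suc (s + s)) g
    ≡⟨ cong (λ z → ∑ z g) (sym (+-suc s s)) ⟩
  ∑ (s + suc s) g
    ≡⟨ ∑-split s (suc s) g ⟩
  ∑ s g + ∑ (suc s) (λ x → g (s + x))
    ≡⟨ cong (∑ s g +_) (∑-shift s (λ x → g (s + x))) ⟩
  ∑ s g + (g (s + 1) + upper)
    ≡⟨ cong (λ z → ∑ s g + (g z + upper)) (+-comm s 1) ⟩
  ∑ s g + (g (suc s) + upper)
    ≡⟨ cong (λ z → ∑ s g + (g (suc s) + z)) (∑-reverse s _) ⟩
  ∑ s g + (g (suc s) + ∑ s (λ x → g (s + suc (suc s ∸ x))))
    ≡⟨ cong (λ z → ∑ s g + (g (suc s) + z)) (∑-cong s (λ x 1≤x x≤s → cong g (reflect x 1≤x x≤s))) ⟩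
  ∑ s g + (g (suc s) + ∑ s (λ x → g (M ∸ x)))
    ≡⟨ x∙yz≈xz∙y (∑ s g) (g (suc s)) _ ⟩
  ∑ s g + ∑ s (λ x → g (M ∸ x)) + g (suc s)
    ≡⟨ cong (_+ g (suc s)) (sym (∑-distrib-+ s g _)) ⟩
  ∑ s (λ a → g a + g (M ∸ a)) + g (suc s) ∎)
  where
  M = suc (suc (s + s))
  upper = ∑ s (λ x → g (s + suc x))
  reflect : ∀ x → 1 ≤ x → x ≤ s → s + suc (suc s ∸ x) ≡ M ∸ x
  reflect (suc x) _ 1+x≤s = trans (+-suc s _) (trans (cong suc (sym (+-∸-assoc s x≤s)))
                                  (sym (+-∸-assoc 1 (≤-trans x≤s (m≤m+n s s)))))
    where x≤s = ≤-trans (n≤1+n x) 1+x≤s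

triangle : ℕ → ℕ
triangle n = ∑ n (λ x → x)

triangle-*2 : ∀ n → triangle n * 2 ≡ n * suc n
triangle-*2 zero    = refl
triangle-*2 (suc n) = begin-equality
  (triangle n + suc n) * 2      ≡⟨ *-distribʳ-+ 2 (triangle n) (suc n) ⟩
  triangle n * 2 + suc n * 2    ≡⟨ cong (_+ suc n * 2) (triangle-*2 n) ⟩
  n * suc n + suc n * 2         ≡⟨ expand n ⟩
  suc n * suc (suc n)           ∎
  where
  expand : ∀ n → n * suc n + suc n * 2 ≡ suc n * suc (suc n)
  expand = solve-∀

triangle-closed : ∀ n → (n * suc n) / 2 ≡ triangle n
triangle-closed n = trans (cong (_/ 2) (sym (triangle-*2 n))) (m*n/n≡m (triangle n) 2)

n≤triangle : ∀ n → n ≤ triangle n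
n≤triangle zero    = z≤n
n≤triangle (suc n) = m≤n+m (suc n) (triangle n)

triangle-mono-≤ : ∀ {a b} → a ≤ b → triangle a ≤ triangle b
triangle-mono-≤ {a} {zero}  z≤n = ≤-refl
triangle-mono-≤ {a} {suc b} a≤1+b with a ≟ suc b
... | yes refl = ≤-refl
... | no  a≢1+b = ≤-trans (triangle-mono-≤ (≤-pred (≤∧≢⇒< a≤1+b a≢1+b))) (m≤m+n _ _)

T+d≡triangle : ∀ n d → d ≤ n → T n d + d ≡ triangle n
T+d≡triangle n d d≤n = trans (cong (λ z → z ∸ d + d) (triangle-closed n)) (m∸n+n≡m (≤-trans d≤n (n≤triangle n)))

occ : List ℕ → ℕ → ℕ
occ []       x = 0
occ (y ∷ ys) x = 𝟙 (x ≟ y) + occ ys x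

InRange : ℕ → ℕ → Set
InRange M y = (1 ≤ y) × (y ≤ M)

sum-map-∑ : ∀ M (f : ℕ → ℕ) L → All (InRange M) L → sum (map f L) ≡ ∑ M (λ x → occ L x * f x)
sum-map-∑ M f []       []                 = sym (trans (∑-const M 0) (*-zeroʳ M))
sum-map-∑ M f (y ∷ ys) ((1≤y , y≤M) ∷ ys∈) = begin-equality
  f y + sum (map f ys)
    ≡⟨ cong₂ _+_ (sym (∑-𝟙≟ M y f 1≤y y≤M)) (sum-map-∑ M f ys ys∈) ⟩
  ∑ M (λ x → 𝟙 (x ≟ y) * f x) + ∑ M (λ x → occ ys x * f x)
    ≡⟨ sym (∑-distrib-+ M _ _) ⟩
  ∑ M (λ x → 𝟙 (x ≟ y) * f x + occ ys x * f x)
    ≡⟨ ∑-cong M (λ x _ _ → sym (*-distribʳ-+ (f x) (𝟙 (x ≟ y)) (occ ys x))) ⟩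
  ∑ M (λ x → occ (y ∷ ys) x * f x) ∎

sum-∑ : ∀ M L → All (InRange M) L → sum L ≡ ∑ M (λ x → occ L x * x)
sum-∑ M L L∈ = trans (cong sum (sym (map-id L))) (sum-map-∑ M (λ x → x) L L∈)

length≡sum-map-1 : ∀ (L : List ℕ) → length L ≡ sum (map (λ _ → 1) L)
length≡sum-map-1 []      = refl
length≡sum-map-1 (x ∷ L) = cong suc (length≡sum-map-1 L)

length-∑ : ∀ M L → All (InRange M) L → length L ≡ ∑ M (occ L)
length-∑ M L L∈ = trans (length≡sum-map-1 L) (trans (sum-map-∑ M (λ _ → 1) L L∈) (∑-cong M (λ x _ _ → *-identityʳ _)))

length-filter-∑ : ∀ M {p} {P : Pred ℕ p} (P? : Decidable P) L → All (InRange M) L →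
                  length (filter P? L) ≡ ∑ M (λ x → occ L x * 𝟙 (P? x))
length-filter-∑ M P? L L∈ = trans (length-filter P? L) (sum-map-∑ M _ L L∈)
  where
  length-filter : ∀ {p} {P : Pred ℕ p} (P? : Decidable P) L → length (filter P? L) ≡ sum (map (λ x → 𝟙 (P? x)) L)
  length-filter P? []      = refl
  length-filter P? (x ∷ L) with P? x
  ... | yes _ = cong suc (length-filter P? L)
  ... | no  _ = length-filter P? L

head<∈tail : ∀ {x xs} → Linked _<_ (x ∷ xs) → ∀ {z} → z ∈ xs → x < z
head<∈tail (x<y ∷ _)   (here refl) = x<y
head<∈tail (x<y ∷ y↗) (there z∈) = <-trans x<y (head<∈tail y↗ z∈)

occ-∉ : ∀ L x → x ∉ L → occ L x ≡ 0
occ-∉ []      x _   = refl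
occ-∉ (y ∷ L) x x∉ with x ≟ y
... | yes refl = ⊥-elim (x∉ (here refl))
... | no  _    = occ-∉ L x (x∉ ∘ there)

occ-↗ : ∀ L x → Linked _<_ L → occ L x ≡ 𝟙 (x ∈? L)
occ-↗ []      x _  = refl
occ-↗ (y ∷ L) x L↗ with x ≟ y
... | yes refl = cong suc (occ-∉ L x (λ x∈ → <-irrefl refl (head<∈tail L↗ x∈)))
... | no  _ with x ∈? L | occ-↗ L x (Linked.tail L↗)
...   | yes _ | eq = eq
...   | no  _ | eq = eq

occ-unique-∈ : ∀ {L x} → Unique L → x ∈ L → occ L x ≡ 1
occ-unique-∈ {y ∷ L} {x} (y∉L ∷ _) (here refl) with x ≟ x
... | yes _   = cong suc (occ-∉ L x (λ x∈ → All.lookup y∉L x∈ refl))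
... | no  x≢x = ⊥-elim (x≢x refl)
occ-unique-∈ {y ∷ L} {x} (y∉L ∷ L!) (there x∈) with x ≟ y
... | yes refl = ⊥-elim (All.lookup y∉L x∈ refl)
... | no  _    = occ-unique-∈ L! x∈

↗-ext : ∀ xs ys → Linked _<_ xs → Linked _<_ ys →
        (∀ {z} → z ∈ xs → z ∈ ys) → (∀ {z} → z ∈ ys → z ∈ xs) → xs ≡ ys
↗-ext []       []       _   _   _  _  = refl
↗-ext []       (y ∷ ys) _   _   _  ⊇ with ⊇ (here refl)
... | ()
↗-ext (x ∷ xs) []       _   _   ⊆  _ with ⊆ (here refl)
... | ()
↗-ext (x ∷ xs) (y ∷ ys) xs↗ ys↗ ⊆ ⊇ =
  cong₂ _∷_ x≡y (↗-ext xs ys (Linked.tail xs↗) (Linked.tail ys↗) ⊆′ ⊇′)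
  where
  x≡y : x ≡ y
  x≡y with ⊆ (here refl) | ⊇ (here refl)
  ... | here eq   | _         = eq
  ... | there x∈  | here eq   = sym eq
  ... | there x∈  | there y∈  = ⊥-elim (<-asym (head<∈tail ys↗ x∈) (head<∈tail xs↗ y∈))
  ⊆′ : ∀ {z} → z ∈ xs → z ∈ ys
  ⊆′ z∈ with ⊆ (there z∈)
  ... | here refl = ⊥-elim (<-irrefl x≡y (head<∈tail xs↗ z∈))
  ... | there z∈′ = z∈′
  ⊇′ : ∀ {z} → z ∈ ys → z ∈ xs
  ⊇′ z∈ with ⊇ (there z∈)
  ... | here refl = ⊥-elim (<-irrefl (sym x≡y) (head<∈tail ys↗ z∈))
  ... | there z∈′ = z∈′

≤-largest : ∀ {x} L → x ∈ L → x ≤ largest L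
≤-largest (y ∷ L) (here refl) = m≤m⊔n y _
≤-largest (y ∷ L) (there x∈)  = ≤-trans (≤-largest L x∈) (m≤n⊔m y _)

largest-≤ : ∀ M L → All (_≤ M) L → largest L ≤ M
largest-≤ M []      []           = z≤n
largest-≤ M (y ∷ L) (y≤M ∷ L≤M) = ⊔-lub y≤M (largest-≤ M L L≤M)

largest-∈ : ∀ y L → largest (y ∷ L) ∈ y ∷ L
largest-∈ y []      rewrite ⊔-identityʳ y = here refl
largest-∈ y (z ∷ L) with ⊔-sel y (largest (z ∷ L))
... | inj₁ eq rewrite eq = here refl
... | inj₂ eq rewrite eq = there (largest-∈ z L)

range : ℕ → List ℕ
range n = applyUpTo suc n

range-↗ : ∀ n → Linked _<_ (range n)
range-↗ n = applyUpTo⁺₂ suc n (λ i → n<1+n (suc i))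

∈-range⁺ : ∀ {n x} → 1 ≤ x → x ≤ n → x ∈ range n
∈-range⁺ {n} {suc x} _ 1+x≤n = ∈-applyUpTo⁺ suc 1+x≤n

∈-range⁻ : ∀ {n x} → x ∈ range n → InRange n x
∈-range⁻ x∈ with ∈-applyUpTo⁻ suc x∈
... | i , i<n , refl = s≤s z≤n , i<n

largest-∈-nonempty : ∀ L → 1 ≤ length L → largest L ∈ L
largest-∈-nonempty (y ∷ L) _ = largest-∈ y L

m+m<n⇒m<n∸m : ∀ m n → m + m < n → m < n ∸ m
m+m<n⇒m<n∸m m n m+m<n =
  ≤-trans (≤-reflexive (sym (m+n∸m≡n m (suc m)))) (∸-monoˡ-≤ m (≤-trans (≤-reflexive (+-suc m m)) m+m<n))

1+m+m≤n+n⇒m<n : ∀ m n → suc (m + m) ≤ n + n → m < n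
1+m+m≤n+n⇒m<n m n 1+2m≤2n with suc m ≤? n
... | yes m<n = m<n
... | no  m≮n = ⊥-elim (<⇒≱ 1+2m≤2n (+-mono-≤ (≤-pred (≰⇒> m≮n)) (≤-pred (≰⇒> m≮n))))

even-or-odd : ∀ m → ∃ λ s → m ≡ s + s ⊎ m ≡ suc (s + s)
even-or-odd zero = 0 , inj₁ refl
even-or-odd (suc m) with even-or-odd m
... | s , inj₁ eq = s , inj₂ (cong suc eq)
... | s , inj₂ eq = suc s , inj₁ (trans (cong suc eq) (cong suc (sym (+-suc s s))))

positive-odd-or-even : ∀ m → 1 ≤ m → ∃ λ s → m ≡ suc (s + s) ⊎ m ≡ suc (suc (s + s))
positive-odd-or-even m 1≤m with even-or-odd m
... | s     , inj₂ eq   = s , inj₁ eq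
... | zero  , inj₁ refl = ⊥-elim (<⇒≱ 1≤m z≤n)
... | suc s , inj₁ eq   = s , inj₂ (trans eq (cong suc (+-suc s s)))

∑-excess-even-or-≥ : ∀ K s (w : ℕ → ℕ) →
  (∀ a → 1 ≤ a → a ≤ s → (∃ λ t → w a ≡ a + 2 * t) ⊎ (a + K ≤ w a)) →
  (∃ λ t → ∑ s w ≡ triangle s + 2 * t) ⊎ (triangle s + K ≤ ∑ s w)
∑-excess-even-or-≥ K zero    w _    = inj₁ (0 , refl)
∑-excess-even-or-≥ K (suc s) w term
  with ∑-excess-even-or-≥ K s w (λ a 1≤a a≤s → term a 1≤a (m≤n⇒m≤1+n a≤s)) | term (suc s) z<s ≤-refl
... | inj₁ (t , eq) | inj₁ (t′ , eq′) = inj₁ (t + t′ , trans (cong₂ _+_ eq eq′) (regroup (triangle s) (suc s) t t′))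
  where
  regroup : ∀ a b t t′ → a + 2 * t + (b + 2 * t′) ≡ a + b + 2 * (t + t′)
  regroup = solve-∀
... | inj₁ (t , eq) | inj₂ big = inj₂ (begin
  triangle s + suc s + K          ≡⟨ +-assoc (triangle s) (suc s) K ⟩
  triangle s + (suc s + K)        ≤⟨ +-mono-≤ (m≤m+n (triangle s) (2 * t)) big ⟩
  triangle s + 2 * t + w (suc s)  ≡⟨ cong (_+ w (suc s)) (sym eq) ⟩
  ∑ (suc s) w                     ∎)
... | inj₂ big | inj₁ (t , eq) = inj₂ (begin
  triangle s + suc s + K          ≡⟨ xy∙z≈xz∙y (triangle s) (suc s) K ⟩
  triangle s + K + suc s          ≤⟨ +-mono-≤ big (m≤m+n (suc s) (2 * t)) ⟩
  ∑ s w + (suc s + 2 * t)         ≡⟨ cong (∑ s w +_) (sym eq) ⟩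
  ∑ (suc s) w                     ∎)
... | inj₂ big | inj₂ big′ = inj₂ (begin
  triangle s + suc s + K          ≡⟨ xy∙z≈xz∙y (triangle s) (suc s) K ⟩
  triangle s + K + suc s          ≤⟨ +-monoʳ-≤ (triangle s + K) (m≤m+n (suc s) K) ⟩
  triangle s + K + (suc s + K)    ≤⟨ +-mono-≤ big big′ ⟩
  ∑ (suc s) w                     ∎)

Canonical : ℕ → ℕ → Set
Canonical s x = (1 ≤ x × x ≤ suc s) ⊎ x ≡ suc (s + s)

module UnrefinablePartition {N ps} (dp : DistinctPartition N ps) (ur : Unrefinable ps) where
  open DistinctPartition dp

  m : ℕ
  m = largest ps

  c : ℕ → ℕ
  c = occ ps

  m∈ps : m ∈ ps
  m∈ps = largest-∈-nonempty ps (≤-trans (s≤s z≤n) atLeastTwo)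

  ps⊆[1,m] : All (InRange m) ps
  ps⊆[1,m] = All.tabulate (λ x∈ → All.lookup positive x∈ , ≤-largest ps x∈)

  c-∈ : ∀ {x} → x ∈ ps → c x ≡ 1
  c-∈ {x} x∈ = trans (occ-↗ ps x increasing) (𝟙-yes (x ∈? ps) x∈)

  c-∉ : ∀ {x} → x ∉ ps → c x ≡ 0
  c-∉ {x} = occ-∉ ps x

  c≡1⇒∈ : ∀ {x} → c x ≡ 1 → x ∈ ps
  c≡1⇒∈ {x} cx≡1 with x ∈? ps
  ... | yes x∈ = x∈
  ... | no  x∉ = contradiction (trans (sym cx≡1) (c-∉ x∉)) (λ ())

  data Cover (a b : ℕ) : Set where
    left  : c a ≡ 1 → c b ≡ 0 → Cover a b
    right : c a ≡ 0 → c b ≡ 1 → Cover a b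
    both  : c a ≡ 1 → c b ≡ 1 → Cover a b

  cover : ∀ {M} → m ≡ M → ∀ a → 1 ≤ a → a + a < M → Cover a (M ∸ a)
  cover refl a 1≤a a+a<m with a ∈? ps | (m ∸ a) ∈? ps
  ... | yes a∈ | yes b∈ = both  (c-∈ a∈) (c-∈ b∈)
  ... | yes a∈ | no  b∉ = left  (c-∈ a∈) (c-∉ b∉)
  ... | no  a∉ | yes b∈ = right (c-∉ a∉) (c-∈ b∈)
  ... | no  a∉ | no  b∉ = ⊥-elim (ur (a , m ∸ a , <⇒≢ a<b , (1≤a , a≤m , a∉) , (1≤b , m∸n≤m m a , b∉) , a+b∈ps))
    where
    a<b = m+m<n⇒m<n∸m a m a+a<m
    a≤m = ≤-trans (m≤m+n a a) (<⇒≤ a+a<m)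
    1≤b = ≤-trans 1≤a (<⇒≤ a<b)
    a+b∈ps = subst (_∈ ps) (sym (m+[n∸m]≡n a≤m)) m∈ps

  c-largest : ∀ {M} → m ≡ M → c M ≡ 1
  c-largest m≡M = subst (λ z → c z ≡ 1) m≡M (c-∈ m∈ps)

  weight : ℕ → ℕ → ℕ
  weight M a = c a * a + c (M ∸ a) * (M ∸ a)

  pairCount : ℕ → ℕ → ℕ
  pairCount M a = c a + c (M ∸ a)

  ≤-weight : ∀ {a b} → Cover a b → a ≤ b → a ≤ c a * a + c b * b
  ≤-weight {a} {b} (left  ca cb) _   rewrite ca | cb = ≤-trans (≤-reflexive (sym (+-identityʳ a))) (m≤m+n _ _)
  ≤-weight {a} {b} (right ca cb) a≤b rewrite ca | cb = ≤-trans a≤b (≤-reflexive (sym (+-identityʳ b)))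
  ≤-weight {a} {b} (both  ca cb) _   rewrite ca | cb = ≤-trans (≤-reflexive (sym (+-identityʳ a))) (m≤m+n _ _)

  triangle≤∑weight : ∀ s {M} → m ≡ M → (∀ a → a ≤ s → a + a < M) → triangle s ≤ ∑ s (weight M)
  triangle≤∑weight s {M} m≡M small = ∑-mono-≤ s λ a 1≤a a≤s →
    ≤-weight (cover m≡M a 1≤a (small a a≤s)) (<⇒≤ (m+m<n⇒m<n∸m a M (small a a≤s)))

  N≡∑c*x : ∀ {M} → m ≡ M → N ≡ ∑ M (λ x → c x * x)
  N≡∑c*x m≡M = trans (sym sums) (trans (sum-∑ m ps ps⊆[1,m]) (cong (λ z → ∑ z (λ x → c x * x)) m≡M))

  N-odd : ∀ s → m ≡ suc (s + s) → N ≡ ∑ s (weight (suc (s + s))) + suc (s + s)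
  N-odd s m≡M = begin-equality
    N                                        ≡⟨ N≡∑c*x m≡M ⟩
    ∑ M (λ x → c x * x)                      ≡⟨ ∑-pair-odd s (λ x → c x * x) ⟩
    ∑ s (weight M) + c M * M                 ≡⟨ cong (λ z → ∑ s (weight M) + z * M) (c-largest m≡M) ⟩
    ∑ s (weight M) + 1 * M                   ≡⟨ cong (∑ s (weight M) +_) (*-identityˡ M) ⟩
    ∑ s (weight M) + M                       ∎
    where M = suc (s + s)

  N-even : ∀ s → m ≡ suc (suc (s + s)) →
           N ≡ ∑ s (weight (suc (suc (s + s)))) + c (suc s) * suc s + suc (suc (s + s))
  N-even s m≡M = begin-equality
    N                                              ≡⟨ N≡∑c*x m≡M ⟩
    ∑ M (λ x → c x * x)                            ≡⟨ ∑-pair-even s (λ x → c x * x) ⟩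
    ∑ s (weight M) + c (suc s) * suc s + c M * M   ≡⟨ cong (λ z → ∑ s (weight M) + c (suc s) * suc s + z * M) (c-largest m≡M) ⟩
    ∑ s (weight M) + c (suc s) * suc s + 1 * M     ≡⟨ cong (∑ s (weight M) + c (suc s) * suc s +_) (*-identityˡ M) ⟩
    ∑ s (weight M) + c (suc s) * suc s + M         ∎
    where M = suc (suc (s + s))

  length-odd : ∀ s → m ≡ suc (s + s) → length ps ≡ ∑ s (pairCount (suc (s + s))) + 1
  length-odd s m≡M = begin-equality
    length ps                      ≡⟨ length-∑ m ps ps⊆[1,m] ⟩
    ∑ m c                          ≡⟨ cong (λ z → ∑ z c) m≡M ⟩
    ∑ M c                          ≡⟨ ∑-pair-odd s c ⟩
    ∑ s (pairCount M) + c M        ≡⟨ cong (∑ s (pairCount M) +_) (c-largest m≡M) ⟩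
    ∑ s (pairCount M) + 1          ∎
    where M = suc (s + s)

  triangle+m≤N : ∀ s → m ≡ suc (s + s) ⊎ m ≡ suc (suc (s + s)) → triangle s + m ≤ N
  triangle+m≤N s (inj₁ m≡M) = begin
    triangle s + m
      ≤⟨ +-mono-≤ (triangle≤∑weight s m≡M (λ a a≤s → s≤s (+-mono-≤ a≤s a≤s))) (≤-reflexive m≡M) ⟩
    ∑ s (weight (suc (s + s))) + suc (s + s)  ≡⟨ sym (N-odd s m≡M) ⟩
    N                              ∎
  triangle+m≤N s (inj₂ m≡M) = begin
    triangle s + m
      ≤⟨ +-mono-≤ (triangle≤∑weight s m≡M (λ a a≤s → s≤s (m≤n⇒m≤1+n (+-mono-≤ a≤s a≤s)))) (≤-reflexive m≡M) ⟩
    ∑ s (weight M) + M                        ≤⟨ +-monoˡ-≤ M (m≤m+n (∑ s (weight M)) (c (suc s) * suc s)) ⟩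
    ∑ s (weight M) + c (suc s) * suc s + M    ≡⟨ sym (N-even s m≡M) ⟩
    N                              ∎
    where M = suc (suc (s + s))

  c-01 : ∀ x → c x ≡ 0 ⊎ c x ≡ 1
  c-01 x with x ∈? ps
  ... | yes x∈ = inj₂ (c-∈ x∈)
  ... | no  x∉ = inj₁ (c-∉ x∉)

  largest≤2+2s : ∀ s d → N + d ≡ triangle (3 + s) → 3 ≤ d → m ≤ suc (suc (s + s))
  largest≤2+2s s d N+d≡ 3≤d with m ≤? suc (suc (s + s))
  ... | yes m≤ = m≤
  ... | no  m≰ with positive-odd-or-even m (≤-trans (s≤s z≤n) (≰⇒> m≰))
  ...   | s′ , shape = ⊥-elim (<-irrefl refl (+-cancelˡ-≤ (triangle (suc s)) _ _ (begin
    triangle (suc s) + (6 + (s + s))              ≡⟨ regroup₁ (triangle (suc s)) s ⟩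
    triangle (suc s) + suc (suc (suc (s + s))) + 3 ≤⟨ +-mono-≤ (+-mono-≤ (triangle-mono-≤ s<s′) (≰⇒> m≰)) 3≤d ⟩
    triangle s′ + m + d                           ≤⟨ +-monoˡ-≤ d (triangle+m≤N s′ shape) ⟩
    N + d                                         ≡⟨ N+d≡ ⟩
    triangle (suc s) + suc (suc s) + suc (suc (suc s)) ≡⟨ regroup₂ (triangle (suc s)) s ⟩
    triangle (suc s) + (5 + (s + s))              ∎)))
    where
    regroup₁ : ∀ X s → X + (6 + (s + s)) ≡ X + suc (suc (suc (s + s))) + 3
    regroup₁ = solve-∀
    regroup₂ : ∀ X s → X + suc (suc s) + suc (suc (suc s)) ≡ X + (5 + (s + s))
    regroup₂ = solve-∀
    s<s′ : suc s ≤ s′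
    s<s′ = [ (λ m≡ → 1+m+m≤n+n⇒m<n s s′ (≤-pred (≤-trans (≤-trans (n≤1+n _) (≰⇒> m≰)) (≤-reflexive m≡)))) ,
           (λ m≡ → 1+m+m≤n+n⇒m<n s s′ (≤-pred (≤-pred (≤-trans (≰⇒> m≰) (≤-reflexive m≡))))) ]′ shape

  weight-even : ∀ s → m ≡ suc (suc (s + s)) → ∀ a → 1 ≤ a → a ≤ s →
                (∃ λ t → weight (suc (suc (s + s))) a ≡ a + 2 * t) ⊎ (a + (2 + s) ≤ weight (suc (suc (s + s))) a)
  weight-even s m≡M a 1≤a a≤s with cover m≡M a 1≤a (s≤s (m≤n⇒m≤1+n (+-mono-≤ a≤s a≤s)))
  ... | left  ca cb rewrite ca | cb = inj₁ (0 , +-identityʳ (a + 0))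
  ... | right ca cb rewrite ca | cb = inj₁ (suc s ∸ a , trans (+-identityʳ _) (begin-equality
    M ∸ a                          ≡⟨ cong (_∸ a) (M≡a+a+2q (sym (m+[n∸m]≡n (m≤n⇒m≤1+n a≤s)))) ⟩
    a + (a + 2 * (suc s ∸ a)) ∸ a  ≡⟨ m+n∸m≡n a _ ⟩
    a + 2 * (suc s ∸ a)            ∎))
    where
    M = suc (suc (s + s))
    M≡a+a+2q : ∀ {q} → suc s ≡ a + q → M ≡ a + (a + 2 * q)
    M≡a+a+2q {q} 1+s≡ = trans (cong suc (sym (+-suc s s))) (trans (cong₂ _+_ 1+s≡ 1+s≡) (regroup a q))
      where
      regroup : ∀ a q → a + q + (a + q) ≡ a + (a + 2 * q)
      regroup = solve-∀
  ... | both  ca cb rewrite ca | cb = inj₂ (begin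
    a + (2 + s)                ≤⟨ +-monoˡ-≤ (2 + s) a≤s ⟩
    s + (2 + s)                ≡⟨ trans (+-suc s (suc s)) (cong suc (+-suc s s)) ⟩
    M                          ≡⟨ sym (m+[n∸m]≡n a≤M) ⟩
    a + (M ∸ a)                ≡⟨ cong₂ _+_ (sym (+-identityʳ a)) (sym (+-identityʳ (M ∸ a))) ⟩
    a + 0 + (M ∸ a + 0)        ∎)
    where
    M = suc (suc (s + s))
    a≤M = ≤-trans a≤s (≤-trans (m≤m+n s s) (≤-trans (n≤1+n _) (n≤1+n _)))

  excess-even : ∀ s d → m ≡ suc (suc (s + s)) → N + d ≡ triangle (3 + s) →
                ∑ s (weight (suc (suc (s + s)))) + c (suc s) * suc s + d ≡ triangle s + (4 + s)
  excess-even s d m≡M N+d≡ = +-cancelʳ-≡ M _ _ (begin-equality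
    ∑ s (weight M) + c (suc s) * suc s + d + M   ≡⟨ xy∙z≈xz∙y (∑ s (weight M) + c (suc s) * suc s) d M ⟩
    ∑ s (weight M) + c (suc s) * suc s + M + d   ≡⟨ cong (_+ d) (sym (N-even s m≡M)) ⟩
    N + d                                        ≡⟨ N+d≡ ⟩
    X + suc s + suc (suc s) + suc (suc (suc s))  ≡⟨ regroup X s ⟩
    X + (4 + s) + M                              ∎)
    where
    M = suc (suc (s + s))
    X = triangle s
    regroup : ∀ X s → X + suc s + suc (suc s) + suc (suc (suc s)) ≡ X + (4 + s) + suc (suc (s + s))
    regroup = solve-∀

  -- A pair with a single part contributes a plus an even number; a doubly covered pair already costs too
  -- much, so otherwise d would have the parity of s.
  largest≢2+2s : ∀ s d k → N + d ≡ triangle (3 + s) → d + 2 * k ≡ 3 + s → 4 ≤ d → m ≢ suc (suc (s + s))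
  largest≢2+2s s d k N+d≡ d+2k≡ 4≤d m≡M
    with ∑-excess-even-or-≥ (2 + s) s (weight (suc (suc (s + s)))) (weight-even s m≡M) | c-01 (suc s)
  ... | inj₁ (t , ∑≡) | inj₁ c≡0 = even≢odd t k (+-cancelʳ-≡ d _ _ (+-cancelˡ-≡ (triangle s) _ _ (begin-equality
    X + (2 * t + d)                      ≡⟨ regroup X (2 * t) d ⟩
    X + 2 * t + 0 * suc s + d            ≡⟨ cong₂ (λ u v → u + v * suc s + d) (sym ∑≡) (sym c≡0) ⟩
    ∑ s (weight M) + c (suc s) * suc s + d ≡⟨ excess-even s d m≡M N+d≡ ⟩
    X + (4 + s)                          ≡⟨ cong (λ z → X + suc z) (sym d+2k≡) ⟩
    X + suc (d + 2 * k)                  ≡⟨ cong (λ z → X + suc z) (+-comm d (2 * k)) ⟩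
    X + (suc (2 * k) + d)                ∎)))
    where
    M = suc (suc (s + s))
    X = triangle s
    regroup : ∀ X u d → X + (u + d) ≡ X + u + 0 + d
    regroup = solve-∀
  ... | inj₁ (t , ∑≡) | inj₂ c≡1 =
    <⇒≱ 4≤d (≤-trans (m≤n+m d (2 * t)) (≤-reflexive (+-cancelˡ-≡ (triangle s + suc s) _ _ (begin-equality
    X + suc s + (2 * t + d)              ≡⟨ regroup X (2 * t) (suc s) d ⟩
    X + 2 * t + 1 * suc s + d            ≡⟨ cong₂ (λ u v → u + v * suc s + d) (sym ∑≡) (sym c≡1) ⟩
    ∑ s (weight M) + c (suc s) * suc s + d ≡⟨ excess-even s d m≡M N+d≡ ⟩
    X + (4 + s)                          ≡⟨ regroup′ X s ⟩
    X + suc s + 3                        ∎))))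
    where
    M = suc (suc (s + s))
    X = triangle s
    regroup : ∀ X u v d → X + v + (u + d) ≡ X + u + 1 * v + d
    regroup = solve-∀
    regroup′ : ∀ X s → X + (4 + s) ≡ X + suc s + 3
    regroup′ = solve-∀
  ... | inj₂ ∑≥ | _ = <⇒≱ 4≤d (m≤n⇒m≤1+n (+-cancelˡ-≤ (triangle s + (2 + s)) _ _ (begin
    X + (2 + s) + d                      ≤⟨ +-monoˡ-≤ d (≤-trans ∑≥ (m≤m+n _ _)) ⟩
    ∑ s (weight M) + c (suc s) * suc s + d ≡⟨ excess-even s d m≡M N+d≡ ⟩
    X + (4 + s)                          ≡⟨ regroup X s ⟩
    X + (2 + s) + 2                      ∎)))
    where
    M = suc (suc (s + s))
    X = triangle s
    regroup : ∀ X s → X + (4 + s) ≡ X + (2 + s) + 2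
    regroup = solve-∀

  module LargestOdd (s d : ℕ) (m≡M : m ≡ suc (s + s)) (length≡ : length ps ≡ 2 + s)
                    (N+d≡ : N + d ≡ triangle (3 + s)) where
    M : ℕ
    M = suc (s + s)

    a+a<M : ∀ a → a ≤ s → a + a < M
    a+a<M a a≤s = s≤s (+-mono-≤ a≤s a≤s)

    a≤M : ∀ a → a ≤ s → a ≤ M
    a≤M a a≤s = ≤-trans a≤s (≤-trans (m≤m+n s s) (n≤1+n _))

    -- A doubly covered pair costs at least s + 1 more than a, and the pair counts add up to s + 1.
    weight-odd : ∀ a → 1 ≤ a → a ≤ s → a + suc s * pairCount M a ≤ weight M a + suc s
    weight-odd a 1≤a a≤s with cover m≡M a 1≤a (a+a<M a a≤s)
    ... | left  ca cb rewrite ca | cb = ≤-reflexive (regroup a (M ∸ a) s)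
      where
      regroup : ∀ a b s → a + suc s * (1 + 0) ≡ 1 * a + 0 * b + suc s
      regroup = solve-∀
    ... | right ca cb rewrite ca | cb = begin
      a + suc s * (0 + 1)           ≡⟨ regroup a s ⟩
      a + suc s                     ≤⟨ +-monoˡ-≤ (suc s) (<⇒≤ (m+m<n⇒m<n∸m a M (a+a<M a a≤s))) ⟩
      M ∸ a + suc s                 ≡⟨ regroup′ a (M ∸ a) s ⟩
      0 * a + 1 * (M ∸ a) + suc s   ∎
      where
      regroup : ∀ a s → a + suc s * (0 + 1) ≡ a + suc s
      regroup = solve-∀
      regroup′ : ∀ a b s → b + suc s ≡ 0 * a + 1 * b + suc s
      regroup′ = solve-∀
    ... | both  ca cb rewrite ca | cb = begin
      a + suc s * (1 + 1)           ≡⟨ regroup a s ⟩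
      a + (suc s + suc s)           ≤⟨ +-monoˡ-≤ (suc s + suc s) a≤s ⟩
      s + (suc s + suc s)           ≡⟨ regroup′ s ⟩
      M + suc s                     ≡⟨ cong (_+ suc s) (sym (m+[n∸m]≡n (a≤M a a≤s))) ⟩
      a + (M ∸ a) + suc s           ≡⟨ regroup″ a (M ∸ a) s ⟩
      1 * a + 1 * (M ∸ a) + suc s   ∎
      where
      regroup : ∀ a s → a + suc s * (1 + 1) ≡ a + (suc s + suc s)
      regroup = solve-∀
      regroup′ : ∀ s → s + (suc s + suc s) ≡ suc (s + s) + suc s
      regroup′ = solve-∀
      regroup″ : ∀ a b s → a + b + suc s ≡ 1 * a + 1 * b + suc s
      regroup″ = solve-∀

    ∑pairCount≡1+s : ∑ s (pairCount M) ≡ suc s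
    ∑pairCount≡1+s = suc-injective (trans (+-comm 1 _) (trans (sym (length-odd s m≡M)) length≡))

    ∑-weight+const : ∑ s (λ a → weight M a + suc s) ≡ s * suc s + ∑ s (weight M)
    ∑-weight+const = trans (∑-distrib-+ s (weight M) _)
      (trans (cong (∑ s (weight M) +_) (∑-const s (suc s))) (+-comm (∑ s (weight M)) (s * suc s)))

    ∑-a+pairCount : ∑ s (λ a → a + suc s * pairCount M a) ≡ triangle s + suc s * suc s
    ∑-a+pairCount = trans (∑-distrib-+ s (λ a → a) _)
      (cong (triangle s +_) (trans (∑-distribˡ-* s (suc s) (pairCount M)) (cong (suc s *_) ∑pairCount≡1+s)))

    ∑weight≥ : triangle s + suc s ≤ ∑ s (weight M)
    ∑weight≥ = +-cancelˡ-≤ (s * suc s) _ _ (begin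
      s * suc s + (triangle s + suc s)               ≡⟨ regroup (triangle s) s ⟩
      triangle s + suc s * suc s                     ≡⟨ sym ∑-a+pairCount ⟩
      ∑ s (λ a → a + suc s * pairCount M a)          ≤⟨ ∑-mono-≤ s weight-odd ⟩
      ∑ s (λ a → weight M a + suc s)                 ≡⟨ ∑-weight+const ⟩
      s * suc s + ∑ s (weight M)                     ∎)
      where
      regroup : ∀ X s → s * suc s + (X + suc s) ≡ X + suc s * suc s
      regroup = solve-∀

    excess-odd : ∑ s (weight M) + d ≡ triangle s + suc s + 4
    excess-odd = +-cancelʳ-≡ M _ _ (begin-equality
      ∑ s (weight M) + d + M                        ≡⟨ xy∙z≈xz∙y (∑ s (weight M)) d M ⟩
      ∑ s (weight M) + M + d                        ≡⟨ cong (_+ d) (sym (N-odd s m≡M)) ⟩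
      N + d                                         ≡⟨ N+d≡ ⟩
      X + suc s + suc (suc s) + suc (suc (suc s))   ≡⟨ regroup X s ⟩
      X + suc s + 4 + M                             ∎)
      where
      X = triangle s
      regroup : ∀ X s → X + suc s + suc (suc s) + suc (suc (suc s)) ≡ X + suc s + 4 + suc (s + s)
      regroup = solve-∀

    d≤4 : d ≤ 4
    d≤4 = +-cancelˡ-≤ (triangle s + suc s) _ _ (begin
      triangle s + suc s + d      ≤⟨ +-monoˡ-≤ d ∑weight≥ ⟩
      ∑ s (weight M) + d          ≡⟨ excess-odd ⟩
      triangle s + suc s + 4      ∎)

    module Tight (d≡4 : d ≡ 4) where
      ∑weight≡ : ∑ s (weight M) ≡ triangle s + suc s
      ∑weight≡ = +-cancelʳ-≡ d _ _ (trans excess-odd (cong (triangle s + suc s +_) (sym d≡4)))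

      weight-odd-tight : ∀ a → 1 ≤ a → a ≤ s → weight M a + suc s ≡ a + suc s * pairCount M a
      weight-odd-tight = ∑-squeeze s _ _ weight-odd (begin-equality
        ∑ s (λ a → weight M a + suc s)          ≡⟨ ∑-weight+const ⟩
        s * suc s + ∑ s (weight M)              ≡⟨ cong (s * suc s +_) ∑weight≡ ⟩
        s * suc s + (triangle s + suc s)        ≡⟨ regroup (triangle s) s ⟩
        triangle s + suc s * suc s              ≡⟨ sym ∑-a+pairCount ⟩
        ∑ s (λ a → a + suc s * pairCount M a)   ∎)
        where
        regroup : ∀ X s → s * suc s + (X + suc s) ≡ X + suc s * suc s
        regroup = solve-∀

      cover-tight : ∀ a → 1 ≤ a → a ≤ s → (c a ≡ 1) × (a < s → c (M ∸ a) ≡ 0)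
      cover-tight a 1≤a a≤s with cover m≡M a 1≤a (a+a<M a a≤s) | weight-odd-tight a 1≤a a≤s
      ... | left  ca cb | _ = ca , λ _ → cb
      ... | right ca cb | tight rewrite ca | cb =
        ⊥-elim (<⇒≢ (m+m<n⇒m<n∸m a M (a+a<M a a≤s))
                    (sym (+-cancelʳ-≡ (suc s) _ _ (trans (regroup a (M ∸ a) s) (trans tight (regroup′ a s))))))
        where
        regroup : ∀ a b s → b + suc s ≡ 0 * a + 1 * b + suc s
        regroup = solve-∀
        regroup′ : ∀ a s → a + suc s * (0 + 1) ≡ a + suc s
        regroup′ = solve-∀
      ... | both  ca cb | tight rewrite ca | cb = refl , λ a<s → ⊥-elim (<-irrefl a≡s a<s)
        where
        a≡s : a ≡ s
        a≡s = sym (+-cancelʳ-≡ (suc s + suc s) _ _ (begin-equality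
          s + (suc s + suc s)           ≡⟨ regroup s ⟩
          M + suc s                     ≡⟨ cong (_+ suc s) (sym (m+[n∸m]≡n (a≤M a a≤s))) ⟩
          a + (M ∸ a) + suc s           ≡⟨ regroup′ a (M ∸ a) s ⟩
          1 * a + 1 * (M ∸ a) + suc s   ≡⟨ tight ⟩
          a + suc s * (1 + 1)           ≡⟨ regroup″ a s ⟩
          a + (suc s + suc s)           ∎))
          where
          regroup : ∀ s → s + (suc s + suc s) ≡ suc (s + s) + suc s
          regroup = solve-∀
          regroup′ : ∀ a b s → a + b + suc s ≡ 1 * a + 1 * b + suc s
          regroup′ = solve-∀
          regroup″ : ∀ a s → a + suc s * (1 + 1) ≡ a + (suc s + suc s)
          regroup″ = solve-∀

      c[1+s]≡1 : c (suc s) ≡ 1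
      c[1+s]≡1 with c-01 (suc s)
      ... | inj₂ c≡1 = c≡1
      ... | inj₁ c≡0 = ⊥-elim (<-irrefl (begin-equality
          s                     ≡⟨ sym (trans (∑-const s 1) (*-identityʳ s)) ⟩
          ∑ s (λ _ → 1)         ≡⟨ ∑-cong s (λ a 1≤a a≤s → sym (pairCount≡1 a 1≤a a≤s)) ⟩
          ∑ s (pairCount M)     ≡⟨ ∑pairCount≡1+s ⟩
          suc s                 ∎) (n<1+n s))
        where
        pairCount≡1 : ∀ a → 1 ≤ a → a ≤ s → pairCount M a ≡ 1
        pairCount≡1 a 1≤a a≤s with a ≟ s
        ... | yes refl = cong₂ _+_ (proj₁ (cover-tight a 1≤a a≤s)) (trans (cong c (m+n∸n≡m (suc s) s)) c≡0)
        ... | no  a≢s  = cong₂ _+_ (proj₁ (cover-tight a 1≤a a≤s)) (proj₂ (cover-tight a 1≤a a≤s) (≤∧≢⇒< a≤s a≢s))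

      ∈⇒Canonical : ∀ {x} → x ∈ ps → Canonical s x
      ∈⇒Canonical {x} x∈ with x ≤? suc s | x ≟ M
      ... | yes x≤1+s | _      = inj₁ (proj₁ (All.lookup ps⊆[1,m] x∈) , x≤1+s)
      ... | no  _     | yes x≡M = inj₂ x≡M
      ... | no  x≰1+s | no  x≢M =
        contradiction (trans (sym (proj₂ (cover-tight a 1≤a (<⇒≤ a<s)) a<s)) (trans (cong c (m∸[m∸n]≡n x≤M)) (c-∈ x∈))) (λ ())
        where
        x≤M = subst (x ≤_) m≡M (proj₂ (All.lookup ps⊆[1,m] x∈))
        x<M = ≤∧≢⇒< x≤M x≢M
        a = M ∸ x
        1≤a : 1 ≤ a
        1≤a = m<n⇒0<n∸m x<M
        a<s : a < s
        a<s = +-cancelʳ-≤ (suc s) (suc a) s (begin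
          suc a + suc s      ≡⟨ sym (+-suc a (suc s)) ⟩
          a + suc (suc s)    ≤⟨ +-monoʳ-≤ a (≰⇒> x≰1+s) ⟩
          a + x              ≡⟨ m∸n+n≡m x≤M ⟩
          M                  ≡⟨ sym (+-suc s s) ⟩
          s + suc s          ∎)

      Canonical⇒∈ : ∀ {x} → Canonical s x → x ∈ ps
      Canonical⇒∈ (inj₂ refl) = subst (_∈ ps) m≡M m∈ps
      Canonical⇒∈ {x} (inj₁ (1≤x , x≤1+s)) with x ≟ suc s
      ... | yes refl = c≡1⇒∈ c[1+s]≡1
      ... | no  x≢1+s = c≡1⇒∈ (proj₁ (cover-tight x 1≤x (≤-pred (≤∧≢⇒< x≤1+s x≢1+s))))

module Edit (K M : ℕ) (removed added : List ℕ) (K≤M : K ≤ M)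
            (removed⊆ : All (InRange K) removed) (added⊆ : All (λ y → K < y × y ≤ M) added)
            (removed! : Unique removed) (added! : Unique added) (M∈added : M ∈ added) where

  Kept : ℕ → Set
  Kept x = (x ≤ K × x ∉ removed) ⊎ x ∈ added

  kept? : (x : ℕ) → Dec (Kept x)
  kept? x = (x ≤? K ×-dec ¬? (x ∈? removed)) ⊎-dec (x ∈? added)

  edited : List ℕ
  edited = filter kept? (range M)

  edited-↗ : Linked _<_ edited
  edited-↗ = filter⁺ kept? <-trans (range-↗ M)

  ∈-edited⁻ : ∀ {x} → x ∈ edited → InRange M x × Kept x
  ∈-edited⁻ x∈ with ∈-filter⁻ kept? x∈
  ... | x∈range , kept = ∈-range⁻ x∈range , kept

  ∈-edited⁺ : ∀ {x} → 1 ≤ x → x ≤ M → Kept x → x ∈ edited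
  ∈-edited⁺ 1≤x x≤M kept = ∈-filter⁺ kept? (∈-range⁺ 1≤x x≤M) kept

  edited⊆[1,M] : All (InRange M) edited
  edited⊆[1,M] = All.tabulate (proj₁ ∘ ∈-edited⁻)

  largest-edited : largest edited ≡ M
  largest-edited = ≤-antisym (largest-≤ M edited (All.map proj₂ edited⊆[1,M])) (≤-largest edited M∈edited)
    where
    M∈edited = ∈-edited⁺ (≤-trans (s≤s z≤n) (proj₁ (All.lookup added⊆ M∈added))) ≤-refl (inj₂ M∈added)

  occ-edited : ∀ x → 1 ≤ x → x ≤ M → occ edited x ≡ 𝟙 (kept? x)
  occ-edited x 1≤x x≤M = trans (occ-↗ edited x edited-↗)
    (𝟙-⇔ (x ∈? edited) (kept? x) (proj₂ ∘ ∈-edited⁻) (∈-edited⁺ 1≤x x≤M))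

  occ-balance : ∀ x → 𝟙 (kept? x) + occ removed x ≡ 𝟙 (x ≤? K) + occ added x
  occ-balance x with toSum (x ∈? added)
  ... | inj₁ x∈A = cong₂ _+_ (𝟙-yes (kept? x) (inj₂ x∈A)) (occ-∉ removed x x∉R)
                  ⟨ trans ⟩ sym (cong₂ _+_ (𝟙-no (x ≤? K) (<⇒≱ K<x)) (occ-unique-∈ added! x∈A))
    where
    K<x = proj₁ (All.lookup added⊆ x∈A)
    x∉R = λ x∈R → <⇒≱ K<x (proj₂ (All.lookup removed⊆ x∈R))
  ... | inj₂ x∉A with toSum (x ∈? removed) | toSum (x ≤? K)
  ...   | inj₁ x∈R | inj₁ x≤K = cong₂ _+_ (𝟙-no (kept? x) [ (λ k → proj₂ k x∈R) , x∉A ]′) (occ-unique-∈ removed! x∈R)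
                              ⟨ trans ⟩ sym (cong₂ _+_ (𝟙-yes (x ≤? K) x≤K) (occ-∉ added x x∉A))
  ...   | inj₁ x∈R | inj₂ x≰K = ⊥-elim (x≰K (proj₂ (All.lookup removed⊆ x∈R)))
  ...   | inj₂ x∉R | inj₁ x≤K = cong₂ _+_ (𝟙-yes (kept? x) (inj₁ (x≤K , x∉R))) (occ-∉ removed x x∉R)
                              ⟨ trans ⟩ sym (cong₂ _+_ (𝟙-yes (x ≤? K) x≤K) (occ-∉ added x x∉A))
  ...   | inj₂ x∉R | inj₂ x≰K = cong₂ _+_ (𝟙-no (kept? x) [ x≰K ∘ proj₁ , x∉A ]′) (occ-∉ removed x x∉R)
                              ⟨ trans ⟩ sym (cong₂ _+_ (𝟙-no (x ≤? K) x≰K) (occ-∉ added x x∉A))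

  sum-map-edited : ∀ (f : ℕ → ℕ) → sum (map f edited) + sum (map f removed) ≡ ∑ K f + sum (map f added)
  sum-map-edited f = begin-equality
    sum (map f edited) + sum (map f removed)
      ≡⟨ cong₂ _+_ (sum-map-∑ M f edited edited⊆[1,M])
                   (sum-map-∑ M f removed (All.map (λ (1≤x , x≤K) → 1≤x , ≤-trans x≤K K≤M) removed⊆)) ⟩
    ∑ M (λ x → occ edited x * f x) + ∑ M (λ x → occ removed x * f x)
      ≡⟨ sym (∑-distrib-+ M _ _) ⟩
    ∑ M (λ x → occ edited x * f x + occ removed x * f x)
      ≡⟨ ∑-cong M (λ x 1≤x x≤M → trans (sym (*-distribʳ-+ (f x) (occ edited x) (occ removed x)))
                                       (cong (_* f x) (trans (cong (_+ occ removed x) (occ-edited x 1≤x x≤M)) (occ-balance x)))) ⟩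
    ∑ M (λ x → (𝟙 (x ≤? K) + occ added x) * f x)
      ≡⟨ trans (∑-cong M (λ x _ _ → *-distribʳ-+ (f x) (𝟙 (x ≤? K)) (occ added x))) (∑-distrib-+ M _ _) ⟩
    ∑ M (λ x → 𝟙 (x ≤? K) * f x) + ∑ M (λ x → occ added x * f x)
      ≡⟨ cong₂ _+_ ∑-up-to-K (sym (sum-map-∑ M f added (All.map (λ (K<x , x≤M) → ≤-trans (s≤s z≤n) K<x , x≤M) added⊆))) ⟩
    ∑ K f + sum (map f added) ∎
    where
    ∑-up-to-K : ∑ M (λ x → 𝟙 (x ≤? K) * f x) ≡ ∑ K f
    ∑-up-to-K = trans (∑-truncate K M _ K≤M (λ x K<x → cong (_* f x) (𝟙-no (x ≤? K) (<⇒≱ K<x))))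
                      (∑-cong K (λ x _ x≤K → trans (cong (_* f x) (𝟙-yes (x ≤? K) x≤K)) (+-identityʳ (f x))))

  sum-edited : sum edited + sum removed ≡ triangle K + sum added
  sum-edited = begin-equality
    sum edited + sum removed                             ≡⟨ cong₂ _+_ (cong sum (sym (map-id edited))) (cong sum (sym (map-id removed))) ⟩
    sum (map (λ x → x) edited) + sum (map (λ x → x) removed) ≡⟨ sum-map-edited (λ x → x) ⟩
    triangle K + sum (map (λ x → x) added)              ≡⟨ cong (λ z → triangle K + sum z) (map-id added) ⟩
    triangle K + sum added                              ∎

  length-edited : length edited + length removed ≡ K + length added
  length-edited = trans (cong₂ _+_ (length≡sum-map-1 edited) (length≡sum-map-1 removed))
    (trans (sum-map-edited (λ _ → 1)) (cong₂ _+_ (trans (∑-const K 1) (*-identityʳ K)) (sym (length≡sum-map-1 added))))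

  NoSplitting : Set
  NoSplitting = ∀ a b → a ≢ b → ¬ Kept a → ¬ Kept b → ¬ Kept (a + b)

  unrefinable-edited : NoSplitting → Unrefinable edited
  unrefinable-edited noSplit (a , b , a≢b , (1≤a , a≤m , a∉) , (1≤b , b≤m , b∉) , a+b∈) =
    noSplit a b a≢b (a∉ ∘ ∈-edited⁺ 1≤a a≤M) (b∉ ∘ ∈-edited⁺ 1≤b b≤M) (proj₂ (∈-edited⁻ a+b∈))
    where
    a≤M = subst (a ≤_) largest-edited a≤m
    b≤M = subst (b ≤_) largest-edited b≤m

  edited∈U : ∀ N → N + sum removed ≡ triangle K + sum added → 2 ≤ length edited → NoSplitting → U N edited
  edited∈U N N+R≡ 2≤length noSplit = record
    { increasing = edited-↗
    ; positive   = All.map proj₁ edited⊆[1,M]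
    ; atLeastTwo = 2≤length
    ; sums       = +-cancelʳ-≡ (sum removed) _ _ (trans sum-edited (sym N+R≡))
    } , unrefinable-edited noSplit

distinct-sum-≥ : ∀ a b k → a ≢ b → k ≤ a → k ≤ b → k + suc k ≤ a + b
distinct-sum-≥ a b k a≢b k≤a k≤b with <-cmp a b
... | tri< a<b _ _   = +-mono-≤ k≤a (≤-trans (s≤s k≤a) a<b)
... | tri≈ _ a≡b _   = ⊥-elim (a≢b a≡b)
... | tri> _ _ b<a   = ≤-trans (+-mono-≤ k≤b (≤-trans (s≤s k≤b) b<a)) (≤-reflexive (+-comm b a))

module IntervalAndTop (s M : ℕ) (1+s<M : suc s < M) (M≤2s+4 : M ≤ s + (s + 4)) where
  open Edit (suc s) M [] (M ∷ []) (<⇒≤ 1+s<M) [] ((1+s<M , ≤-refl) ∷ []) [] ([] ∷ []) (here refl) public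

  ¬kept⇒>1+s : ∀ {a} → ¬ Kept a → suc s < a
  ¬kept⇒>1+s {a} a∉ with suc s <? a
  ... | yes 1+s<a = 1+s<a
  ... | no  1+s≮a = ⊥-elim (a∉ (inj₁ (≮⇒≥ 1+s≮a , λ ())))

  noSplitting : NoSplitting
  noSplitting a b a≢b a∉ b∉ (inj₁ (a+b≤1+s , _)) = <⇒≱ (¬kept⇒>1+s a∉) (≤-trans (m≤m+n a b) a+b≤1+s)
  noSplitting a b a≢b a∉ b∉ (inj₂ (here a+b≡M)) = <⇒≱ (begin-strict
    M                                  ≤⟨ M≤2s+4 ⟩
    s + (s + 4)                        <⟨ ≤-reflexive (expand s) ⟩
    suc (suc s) + suc (suc (suc s))    ≤⟨ distinct-sum-≥ a b (suc (suc s)) a≢b (¬kept⇒>1+s a∉) (¬kept⇒>1+s b∉) ⟩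
    a + b                              ∎) (≤-reflexive a+b≡M)
    where
    expand : ∀ s → suc (s + (s + 4)) ≡ suc (suc s) + suc (suc (suc s))
    expand = solve-∀

  ∈U : ∀ N → N ≡ triangle (suc s) + M → U N edited
  ∈U N N≡ = edited∈U N (trans (+-identityʳ N) (trans N≡ (cong (triangle (suc s) +_) (sym (+-identityʳ M))))) 2≤length noSplitting
    where
    2≤length : 2 ≤ length edited
    2≤length = subst (2 ≤_) (sym (trans (sym (+-identityʳ _)) length-edited)) (s≤s (m≤n+m 1 s))

module SwapMiddle (r : ℕ) where
  K R A M : ℕ
  K = 2 + (r + r)
  R = 2 + r
  A = 4 + (r + (r + r))
  M = 6 + (r + (r + (r + r)))

  K<A : K < A
  K<A = ≤-trans (m≤m+n (3 + (r + r)) (1 + r)) (≤-reflexive (expand r))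
    where
    expand : ∀ r → 3 + (r + r) + (1 + r) ≡ 4 + (r + (r + r))
    expand = solve-∀

  A<M : A < M
  A<M = ≤-trans (m≤m+n (5 + (r + (r + r))) (1 + r)) (≤-reflexive (expand r))
    where
    expand : ∀ r → 5 + (r + (r + r)) + (1 + r) ≡ 6 + (r + (r + (r + r)))
    expand = solve-∀

  open Edit K M (R ∷ []) (A ∷ M ∷ []) (<⇒≤ (<-trans K<A A<M))
            ((s≤s z≤n , s≤s (s≤s (m≤n+m r r))) ∷ [])
            ((K<A , <⇒≤ A<M) ∷ (<-trans K<A A<M , ≤-refl) ∷ [])
            ([] ∷ [])
            ((<⇒≢ A<M ∷ []) ∷ [] ∷ [])
            (there (here refl))
    public

  ¬kept : ∀ {a} → ¬ Kept a → a ≡ R ⊎ (K < a × a ≢ A)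
  ¬kept {a} a∉ with a ≤? K | a ≟ R
  ... | _       | yes a≡R  = inj₁ a≡R
  ... | yes a≤K | no  a≢R  = ⊥-elim (a∉ (inj₁ (a≤K , λ { (here a≡R) → a≢R a≡R })))
  ... | no  a≰K | no  _    = inj₂ (≰⇒> a≰K , λ a≡A → a∉ (inj₂ (here a≡A)))

  kept⇒≤M : ∀ {x} → Kept x → x ≤ M
  kept⇒≤M (inj₁ (x≤K , _))        = ≤-trans x≤K (<⇒≤ (<-trans K<A A<M))
  kept⇒≤M (inj₂ (here refl))         = <⇒≤ A<M
  kept⇒≤M (inj₂ (there (here refl))) = ≤-refl

  R+large : ∀ b → K < b → b ≢ A → ¬ Kept (R + b)
  R+large b K<b b≢A (inj₁ (R+b≤K , _)) = <⇒≱ K<b (≤-trans (m≤n+m b R) R+b≤K)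
  R+large b K<b b≢A (inj₂ (here R+b≡A)) = <⇒≱ (begin-strict
    A                 <⟨ ≤-reflexive (expand r) ⟩
    R + suc K         ≤⟨ +-monoʳ-≤ R K<b ⟩
    R + b             ∎) (≤-reflexive R+b≡A)
    where
    expand : ∀ r → suc (4 + (r + (r + r))) ≡ 2 + r + suc (2 + (r + r))
    expand = solve-∀
  R+large b K<b b≢A (inj₂ (there (here R+b≡M))) = b≢A (+-cancelˡ-≡ R _ _ (trans R+b≡M (expand r)))
    where
    expand : ∀ r → 6 + (r + (r + (r + r))) ≡ 2 + r + (4 + (r + (r + r)))
    expand = solve-∀

  noSplitting : NoSplitting
  noSplitting a b a≢b a∉ b∉ a+b∈ with ¬kept a∉ | ¬kept b∉
  ... | inj₁ a≡R          | inj₁ b≡R          = a≢b (trans a≡R (sym b≡R))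
  ... | inj₁ refl         | inj₂ (K<b , b≢A)  = R+large b K<b b≢A a+b∈
  ... | inj₂ (K<a , a≢A)  | inj₁ refl         = R+large a K<a a≢A (subst Kept (+-comm a b) a+b∈)
  ... | inj₂ (K<a , _)    | inj₂ (K<b , _)    = <⇒≱ (begin-strict
    M                 <⟨ ≤-reflexive (expand r) ⟩
    suc K + suc (suc K) ≤⟨ distinct-sum-≥ a b (suc K) a≢b K<a K<b ⟩
    a + b             ∎) (kept⇒≤M a+b∈)
    where
    expand : ∀ r → suc (6 + (r + (r + (r + r)))) ≡ 3 + (r + r) + suc (3 + (r + r))
    expand = solve-∀

  ∈U : ∀ N → N + 4 ≡ triangle (5 + (r + r)) → U N edited
  ∈U N N+4≡ = edited∈U N N+R≡ 2≤length noSplitting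
    where
    N+R≡ : N + (R + 0) ≡ triangle K + (A + (M + 0))
    N+R≡ = +-cancelʳ-≡ 4 _ _ (begin-equality
      N + (R + 0) + 4                       ≡⟨ regroup N r ⟩
      N + 4 + (2 + r)                       ≡⟨ cong (_+ (2 + r)) N+4≡ ⟩
      triangle (5 + (r + r)) + (2 + r)      ≡⟨ regroup′ (triangle K) r ⟩
      triangle K + (A + (M + 0)) + 4        ∎)
      where
      regroup : ∀ N r → N + (2 + r + 0) + 4 ≡ N + 4 + (2 + r)
      regroup = solve-∀
      regroup′ : ∀ X r → X + (3 + (r + r)) + (4 + (r + r)) + (5 + (r + r)) + (2 + r) ≡
                         X + (4 + (r + (r + r)) + (6 + (r + (r + (r + r))) + 0)) + 4
      regroup′ = solve-∀
    2≤length : 2 ≤ length edited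
    2≤length = +-cancelʳ-≤ 1 2 (length edited) (≤-trans (s≤s (s≤s (s≤s z≤n))) (≤-reflexive (trans (expand r) (sym length-edited))))
      where
      expand : ∀ r → 4 + (r + r) ≡ 2 + (r + r) + 2
      expand = solve-∀

module TwoSwaps (u v g : ℕ) (u≢v : u ≢ v) (u<g : u < g) (v<g : v < g) where
  s M R₁ R₂ A₁ A₂ : ℕ
  s  = suc (u + v + g)
  M  = suc (s + s)
  R₁ = suc (v + g)
  R₂ = suc (u + g)
  A₁ = suc (s + u)
  A₂ = suc (s + v)

  u<s : u < s
  u<s = s≤s (≤-trans (m≤m+n u v) (m≤m+n (u + v) g))

  v<s : v < s
  v<s = s≤s (≤-trans (m≤n+m v u) (m≤m+n (u + v) g))

  R₁≤s : R₁ ≤ s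
  R₁≤s = s≤s (≤-trans (≤-reflexive (+-comm v g)) (≤-trans (m≤n+m (g + v) u) (≤-reflexive (regroup u v g))))
    where
    regroup : ∀ u v g → u + (g + v) ≡ u + v + g
    regroup = solve-∀

  R₂≤s : R₂ ≤ s
  R₂≤s = s≤s (≤-trans (≤-reflexive (+-comm u g)) (≤-trans (m≤n+m (g + u) v) (≤-reflexive (regroup u v g))))
    where
    regroup : ∀ u v g → v + (g + u) ≡ u + v + g
    regroup = solve-∀

  s<A₁ : s < A₁
  s<A₁ = s≤s (m≤m+n s u)

  s<A₂ : s < A₂
  s<A₂ = s≤s (m≤m+n s v)

  A₁≤M : A₁ ≤ M
  A₁≤M = s≤s (+-monoʳ-≤ s (<⇒≤ u<s))

  A₂≤M : A₂ ≤ M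
  A₂≤M = s≤s (+-monoʳ-≤ s (<⇒≤ v<s))

  A₁≢M : A₁ ≢ M
  A₁≢M A₁≡M = <⇒≢ u<s (+-cancelˡ-≡ s _ _ (suc-injective A₁≡M))

  A₂≢M : A₂ ≢ M
  A₂≢M A₂≡M = <⇒≢ v<s (+-cancelˡ-≡ s _ _ (suc-injective A₂≡M))

  A₁≢A₂ : A₁ ≢ A₂
  A₁≢A₂ A₁≡A₂ = u≢v (+-cancelˡ-≡ s _ _ (suc-injective A₁≡A₂))

  R₁≢R₂ : R₁ ≢ R₂
  R₁≢R₂ R₁≡R₂ = u≢v (sym (+-cancelʳ-≡ g _ _ (suc-injective R₁≡R₂)))

  open Edit s M (R₁ ∷ R₂ ∷ []) (A₁ ∷ A₂ ∷ M ∷ []) (≤-trans (m≤m+n s s) (n≤1+n _))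
            ((s≤s z≤n , R₁≤s) ∷ (s≤s z≤n , R₂≤s) ∷ [])
            ((s<A₁ , A₁≤M) ∷ (s<A₂ , A₂≤M) ∷ (≤-trans s<A₁ A₁≤M , ≤-refl) ∷ [])
            ((R₁≢R₂ ∷ []) ∷ [] ∷ [])
            ((A₁≢A₂ ∷ A₁≢M ∷ []) ∷ (A₂≢M ∷ []) ∷ [] ∷ [])
            (there (there (here refl)))
    public

  Removed : ℕ → Set
  Removed a = a ≡ R₁ ⊎ a ≡ R₂

  ¬kept : ∀ {a} → ¬ Kept a → Removed a ⊎ (s < a × a ≢ A₁ × a ≢ A₂)
  ¬kept {a} a∉ with a ≤? s | a ≟ R₁ | a ≟ R₂
  ... | _       | yes a≡R₁ | _        = inj₁ (inj₁ a≡R₁)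
  ... | _       | _        | yes a≡R₂ = inj₁ (inj₂ a≡R₂)
  ... | yes a≤s | no  a≢R₁ | no  a≢R₂ =
    ⊥-elim (a∉ (inj₁ (a≤s , λ { (here a≡R₁) → a≢R₁ a≡R₁ ; (there (here a≡R₂)) → a≢R₂ a≡R₂ })))
  ... | no  a≰s | _        | _        =
    inj₂ (≰⇒> a≰s , (λ a≡A₁ → a∉ (inj₂ (here a≡A₁))) , (λ a≡A₂ → a∉ (inj₂ (there (here a≡A₂)))))

  kept⇒≤M : ∀ {x} → Kept x → x ≤ M
  kept⇒≤M (inj₁ (x≤s , _))                = ≤-trans x≤s (≤-trans (m≤m+n s s) (n≤1+n _))
  kept⇒≤M (inj₂ (here refl))                 = A₁≤M
  kept⇒≤M (inj₂ (there (here refl)))         = A₂≤M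
  kept⇒≤M (inj₂ (there (there (here refl)))) = ≤-refl

  R₁+R₂ : R₁ + R₂ ≡ suc (s + g)
  R₁+R₂ = regroup u v g
    where
    regroup : ∀ u v g → suc (v + g) + suc (u + g) ≡ suc (suc (u + v + g) + g)
    regroup = solve-∀

  ¬kept[R₁+R₂] : ¬ Kept (R₁ + R₂)
  ¬kept[R₁+R₂] rewrite R₁+R₂ = λ
    { (inj₁ (1+s+g≤s , _))                 → <⇒≱ (s≤s (m≤m+n s g)) 1+s+g≤s
    ; (inj₂ (here 1+s+g≡A₁))               → <⇒≢ u<g (sym (+-cancelˡ-≡ s _ _ (suc-injective 1+s+g≡A₁)))
    ; (inj₂ (there (here 1+s+g≡A₂)))       → <⇒≢ v<g (sym (+-cancelˡ-≡ s _ _ (suc-injective 1+s+g≡A₂)))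
    ; (inj₂ (there (there (here 1+s+g≡M)))) → <⇒≢ (s≤s (m≤n+m g (u + v))) (+-cancelˡ-≡ s _ _ (suc-injective 1+s+g≡M))
    }

  R₁+A₁ : R₁ + A₁ ≡ M
  R₁+A₁ = regroup u v g
    where
    regroup : ∀ u v g → suc (v + g) + suc (suc (u + v + g) + u) ≡ suc (suc (u + v + g) + suc (u + v + g))
    regroup = solve-∀

  R₂+A₂ : R₂ + A₂ ≡ M
  R₂+A₂ = regroup u v g
    where
    regroup : ∀ u v g → suc (u + g) + suc (suc (u + v + g) + v) ≡ suc (suc (u + v + g) + suc (u + v + g))
    regroup = solve-∀

  removed>g : ∀ {a} → Removed a → g < a
  removed>g (inj₁ refl) = s≤s (m≤n+m g v)
  removed>g (inj₂ refl) = s≤s (m≤n+m g u)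

  removed+large : ∀ a b → Removed a → s < b → b ≢ A₁ → b ≢ A₂ → ¬ Kept (a + b)
  removed+large a b _     s<b _    _    (inj₁ (a+b≤s , _)) = <⇒≱ s<b (≤-trans (m≤n+m b a) a+b≤s)
  removed+large a b a-rem s<b _    _    (inj₂ (here a+b≡A₁)) = <⇒≱ (begin-strict
    A₁             <⟨ ≤-reflexive (regroup s u) ⟩
    suc u + suc s  ≤⟨ +-mono-≤ (≤-trans u<g (<⇒≤ (removed>g a-rem))) s<b ⟩
    a + b          ∎) (≤-reflexive a+b≡A₁)
    where
    regroup : ∀ s u → suc (suc (s + u)) ≡ suc u + suc s
    regroup = solve-∀
  removed+large a b a-rem s<b _    _    (inj₂ (there (here a+b≡A₂))) = <⇒≱ (begin-strict
    A₂             <⟨ ≤-reflexive (regroup s v) ⟩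
    suc v + suc s  ≤⟨ +-mono-≤ (≤-trans v<g (<⇒≤ (removed>g a-rem))) s<b ⟩
    a + b          ∎) (≤-reflexive a+b≡A₂)
    where
    regroup : ∀ s v → suc (suc (s + v)) ≡ suc v + suc s
    regroup = solve-∀
  removed+large a b (inj₁ refl) _ b≢A₁ _ (inj₂ (there (there (here a+b≡M)))) =
    b≢A₁ (+-cancelˡ-≡ R₁ _ _ (trans a+b≡M (sym R₁+A₁)))
  removed+large a b (inj₂ refl) _ _ b≢A₂ (inj₂ (there (there (here a+b≡M)))) =
    b≢A₂ (+-cancelˡ-≡ R₂ _ _ (trans a+b≡M (sym R₂+A₂)))

  noSplitting : NoSplitting
  noSplitting a b a≢b a∉ b∉ a+b∈ with ¬kept a∉ | ¬kept b∉
  ... | inj₂ (s<a , _) | inj₂ (s<b , _) = <⇒≱ (begin-strict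
    M                   <⟨ ≤-trans (n≤1+n _) (≤-reflexive (regroup s)) ⟩
    suc s + suc (suc s) ≤⟨ distinct-sum-≥ a b (suc s) a≢b s<a s<b ⟩
    a + b               ∎) (kept⇒≤M a+b∈)
    where
    regroup : ∀ s → suc (suc (suc (s + s))) ≡ suc s + suc (suc s)
    regroup = solve-∀
  ... | inj₁ a-rem | inj₂ (s<b , b≢A₁ , b≢A₂) = removed+large a b a-rem s<b b≢A₁ b≢A₂ a+b∈
  ... | inj₂ (s<a , a≢A₁ , a≢A₂) | inj₁ b-rem = removed+large b a b-rem s<a a≢A₁ a≢A₂ (subst Kept (+-comm a b) a+b∈)
  ... | inj₁ (inj₁ refl) | inj₁ (inj₁ refl) = a≢b refl
  ... | inj₁ (inj₂ refl) | inj₁ (inj₂ refl) = a≢b refl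
  ... | inj₁ (inj₁ refl) | inj₁ (inj₂ refl) = ¬kept[R₁+R₂] a+b∈
  ... | inj₁ (inj₂ refl) | inj₁ (inj₁ refl) = ¬kept[R₁+R₂] (subst Kept (+-comm R₂ R₁) a+b∈)

  length≡1+s : length edited ≡ suc s
  length≡1+s = +-cancelʳ-≡ 2 _ _ (trans length-edited (+-suc s 2))

  ∈U : ∀ N d → N + d ≡ triangle (3 + s) → d + 2 * (u + v) ≡ 3 + s → U N edited
  ∈U N d N+d≡ d+2k≡ = edited∈U N N+R≡ (subst (2 ≤_) (sym length≡1+s) (s≤s (s≤s z≤n))) noSplitting
    where
    X = triangle s
    N+R≡ : N + (R₁ + (R₂ + 0)) ≡ X + (A₁ + (A₂ + (M + 0)))
    N+R≡ = +-cancelʳ-≡ (d + 2 * (u + v)) _ _ (begin-equality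
      N + (R₁ + (R₂ + 0)) + (d + 2 * (u + v))          ≡⟨ regroup N d (R₁ + (R₂ + 0)) (2 * (u + v)) ⟩
      N + d + (R₁ + (R₂ + 0)) + 2 * (u + v)            ≡⟨ cong (λ z → z + (R₁ + (R₂ + 0)) + 2 * (u + v)) N+d≡ ⟩
      triangle (3 + s) + (R₁ + (R₂ + 0)) + 2 * (u + v) ≡⟨ regroup′ X u v g ⟩
      X + (A₁ + (A₂ + (M + 0))) + (3 + s)              ≡⟨ cong (X + (A₁ + (A₂ + (M + 0))) +_) (sym d+2k≡) ⟩
      X + (A₁ + (A₂ + (M + 0))) + (d + 2 * (u + v))    ∎)
      where
      regroup : ∀ N d R K → N + R + (d + K) ≡ N + d + R + K
      regroup = solve-∀
      regroup′ : ∀ X u v g →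
        X + suc (suc (u + v + g)) + suc (suc (suc (u + v + g))) + suc (suc (suc (suc (u + v + g))))
          + (suc (v + g) + (suc (u + g) + 0)) + 2 * (u + v)
        ≡ X + (suc (suc (u + v + g) + u) + (suc (suc (u + v + g) + v) + (suc (suc (u + v + g) + suc (u + v + g)) + 0)))
          + (3 + suc (u + v + g))
      regroup′ = solve-∀

common : ℕ → List ℕ → List ℕ → ℕ
common M xs ys = ∑ M (λ x → occ xs x * occ ys x)

length-∖+common : ∀ M xs ys → Linked _<_ ys → All (InRange M) xs →
                  length (filter (λ x → ¬? (x ∈? ys)) xs) + common M xs ys ≡ length xs
length-∖+common M xs ys ys↗ xs⊆ = begin-equality
  length (filter (λ x → ¬? (x ∈? ys)) xs) + common M xs ys
    ≡⟨ cong (_+ common M xs ys) (length-filter-∑ M (λ x → ¬? (x ∈? ys)) xs xs⊆) ⟩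
  ∑ M (λ x → occ xs x * 𝟙 (¬? (x ∈? ys))) + common M xs ys
    ≡⟨ sym (∑-distrib-+ M _ _) ⟩
  ∑ M (λ x → occ xs x * 𝟙 (¬? (x ∈? ys)) + occ xs x * occ ys x)
    ≡⟨ ∑-cong M (λ x _ _ → trans (sym (*-distribˡ-+ (occ xs x) _ _)) (cong (occ xs x *_) (complement x))) ⟩
  ∑ M (λ x → occ xs x * 1)
    ≡⟨ ∑-cong M (λ x _ _ → *-identityʳ (occ xs x)) ⟩
  ∑ M (occ xs)
    ≡⟨ sym (length-∑ M xs xs⊆) ⟩
  length xs ∎
  where
  complement : ∀ x → 𝟙 (¬? (x ∈? ys)) + occ ys x ≡ 1
  complement x = trans (cong (𝟙 (¬? (x ∈? ys)) +_) (occ-↗ ys x ys↗)) (𝟙-¬? (x ∈? ys))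

length-∖-symmetric : ∀ M xs ys → Linked _<_ xs → Linked _<_ ys → All (InRange M) xs → All (InRange M) ys →
                     length (filter (λ x → ¬? (x ∈? ys)) xs) + length ys ≡
                     length (filter (λ x → ¬? (x ∈? xs)) ys) + length xs
length-∖-symmetric M xs ys xs↗ ys↗ xs⊆ ys⊆ = begin-equality
  xs∖ys + length ys                     ≡⟨ cong (xs∖ys +_) (sym (length-∖+common M ys xs xs↗ ys⊆)) ⟩
  xs∖ys + (ys∖xs + common M ys xs)      ≡⟨ x∙yz≈y∙xz xs∖ys ys∖xs _ ⟩
  ys∖xs + (xs∖ys + common M ys xs)      ≡⟨ cong (λ z → ys∖xs + (xs∖ys + z)) common-comm ⟩
  ys∖xs + (xs∖ys + common M xs ys)      ≡⟨ cong (ys∖xs +_) (length-∖+common M xs ys ys↗ xs⊆) ⟩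
  ys∖xs + length xs                     ∎
  where
  xs∖ys = length (filter (λ x → ¬? (x ∈? ys)) xs)
  ys∖xs = length (filter (λ x → ¬? (x ∈? xs)) ys)
  common-comm = ∑-cong M (λ x _ _ → *-comm (occ ys x) (occ xs x))

π-↗ : ∀ n d → Linked _<_ (π n d)
π-↗ n d = filter⁺ (λ x → ¬? (x ≟ d)) <-trans (range-↗ n)

π⊆[1,M] : ∀ n d M → n ≤ M → All (InRange M) (π n d)
π⊆[1,M] n d M n≤M = All.tabulate λ x∈ →
  let (1≤x , x≤n) = ∈-range⁻ (proj₁ (∈-filter⁻ (λ x → ¬? (x ≟ d)) x∈)) in 1≤x , ≤-trans x≤n n≤M

length-π : ∀ n d → 1 ≤ d → d ≤ n → length (π n d) + 1 ≡ n
length-π n d 1≤d d≤n = begin-equality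
  length (π n d) + 1
    ≡⟨ cong₂ _+_ (length-filter-∑ n (λ x → ¬? (x ≟ d)) (range n) (All.tabulate ∈-range⁻))
                 (sym (∑-𝟙≟ n d (λ _ → 1) 1≤d d≤n)) ⟩
  ∑ n (λ x → occ (range n) x * 𝟙 (¬? (x ≟ d))) + ∑ n (λ x → 𝟙 (x ≟ d) * 1)
    ≡⟨ sym (∑-distrib-+ n _ _) ⟩
  ∑ n (λ x → occ (range n) x * 𝟙 (¬? (x ≟ d)) + 𝟙 (x ≟ d) * 1)
    ≡⟨ ∑-cong n term≡1 ⟩
  ∑ n (λ _ → 1)
    ≡⟨ trans (∑-const n 1) (*-identityʳ n) ⟩
  n ∎
  where
  occ-range : ∀ x → 1 ≤ x → x ≤ n → occ (range n) x ≡ 1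
  occ-range x 1≤x x≤n = trans (occ-↗ (range n) x (range-↗ n)) (𝟙-yes (x ∈? range n) (∈-range⁺ 1≤x x≤n))
  term≡1 : ∀ x → 1 ≤ x → x ≤ n → occ (range n) x * 𝟙 (¬? (x ≟ d)) + 𝟙 (x ≟ d) * 1 ≡ 1
  term≡1 x 1≤x x≤n rewrite occ-range x 1≤x x≤n | *-identityʳ (𝟙 (x ≟ d)) =
    trans (cong (_+ 𝟙 (x ≟ d)) (+-identityʳ _)) (𝟙-¬? (x ≟ d))

h+length≡j+length : ∀ n d M ps → n ≤ M → Linked _<_ ps → All (InRange M) ps →
                    h n d ps + length ps ≡ j n d ps + length (π n d)
h+length≡j+length n d M ps n≤M ps↗ ps⊆ = length-∖-symmetric M (π n d) ps (π-↗ n d) ps↗ (π⊆[1,M] n d M n≤M) ps⊆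

2n-5≡1+2s : ∀ s → 2 * (3 + s) ∸ 5 ≡ suc (s + s)
2n-5≡1+2s s = trans (cong (_∸ 5) (expand s)) (m+n∸m≡n 5 (suc (s + s)))
  where
  expand : ∀ s → 2 * (3 + s) ≡ 5 + suc (s + s)
  expand = solve-∀

Maximal : ℕ → ℕ → Set
Maximal N M = ∀ qs → U N qs → largest qs ≤ M

deficit≥4 : ∀ s d N → 1 ≤ d → N + d ≡ triangle (3 + s) → Maximal N (suc (s + s)) → 4 ≤ d
deficit≥4 s d N 1≤d N+d≡ maximal with 4 ≤? d
... | yes 4≤d = 4≤d
... | no  4≰d = ⊥-elim (<⇒≱ 1+2s<largest (maximal edited (∈U N N≡)))
  where
  d≤3 = ≤-pred (≰⇒> 4≰d)
  c = 5 ∸ d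
  M = s + (s + c)
  2≤c : 2 ≤ c
  2≤c = ∸-monoʳ-≤ 5 d≤3
  c+d≡5 : c + d ≡ 5
  c+d≡5 = m∸n+n≡m (≤-trans d≤3 (m≤n+m 3 2))
  1+s<M : suc s < M
  1+s<M = ≤-trans (≤-reflexive (+-comm 2 s)) (+-monoʳ-≤ s (≤-trans 2≤c (m≤n+m c s)))
  open IntervalAndTop s M 1+s<M (+-monoʳ-≤ s (+-monoʳ-≤ s (∸-monoʳ-≤ 5 1≤d)))
  N≡ : N ≡ triangle (suc s) + M
  N≡ = +-cancelʳ-≡ d _ _ (begin-equality
    N + d                                               ≡⟨ N+d≡ ⟩
    triangle (suc s) + suc (suc s) + suc (suc (suc s))  ≡⟨ regroup (triangle (suc s)) s ⟩
    triangle (suc s) + (s + s) + 5                      ≡⟨ cong (triangle (suc s) + (s + s) +_) (sym c+d≡5) ⟩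
    triangle (suc s) + (s + s) + (c + d)                ≡⟨ regroup′ (triangle (suc s)) s c d ⟩
    triangle (suc s) + M + d                            ∎)
    where
    regroup : ∀ X s → X + suc (suc s) + suc (suc (suc s)) ≡ X + (s + s) + 5
    regroup = solve-∀
    regroup′ : ∀ X s c d → X + (s + s) + (c + d) ≡ X + (s + (s + c)) + d
    regroup′ = solve-∀
  1+2s<largest : suc (s + s) < largest edited
  1+2s<largest = ≤-trans (≤-reflexive (regroup s)) (≤-trans (+-monoʳ-≤ s (+-monoʳ-≤ s 2≤c)) (≤-reflexive (sym largest-edited)))
    where
    regroup : ∀ s → suc (suc (s + s)) ≡ s + (s + 2)
    regroup = solve-∀

d≡4⇒2∣n : ∀ s N → 1 ≤ s → N + 4 ≡ triangle (3 + s) → Maximal N (suc (s + s)) → 2 ∣ 3 + s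
d≡4⇒2∣n s N 1≤s N+4≡ maximal with even-or-odd s
... | zero  , inj₁ refl = ⊥-elim (<⇒≱ 1≤s z≤n)
... | suc r , inj₁ refl = ⊥-elim (<⇒≱ 1+2s<largest (maximal edited (∈U N (trans N+4≡ (cong triangle (regroup r))))))
  where
  open SwapMiddle r
  regroup : ∀ r → 3 + (suc r + suc r) ≡ 5 + (r + r)
  regroup = solve-∀
  1+2s<largest : suc ((suc r + suc r) + (suc r + suc r)) < largest edited
  1+2s<largest = ≤-trans (≤-reflexive (expand r)) (≤-reflexive (sym largest-edited))
    where
    expand : ∀ r → suc (suc ((suc r + suc r) + (suc r + suc r))) ≡ 6 + (r + (r + (r + r)))
    expand = solve-∀
... | q , inj₂ refl = divides (2 + q) (regroup q)
  where
  regroup : ∀ q → 3 + suc (q + q) ≡ (2 + q) * 2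
  regroup = solve-∀

module Balanced (s d : ℕ) (2≤s : 2 ≤ s) (1≤d : 1 ≤ d) (d≤2+s : d ≤ 2 + s) {ps : List ℕ}
                (such : Such (3 + s) d ps) (h≡j : h (3 + s) d ps ≡ j (3 + s) d ps) where
  N : ℕ
  N = T (3 + s) d

  maximal : Maximal N (suc (s + s))
  maximal qs qs∈U = subst (largest qs ≤_) (trans (proj₁ (proj₂ such)) (2n-5≡1+2s s)) (proj₂ (proj₁ such) qs qs∈U)

  open UnrefinablePartition (proj₁ (proj₁ (proj₁ such))) (proj₂ (proj₁ (proj₁ such))) public

  m≡M : m ≡ suc (s + s)
  m≡M = trans (proj₁ (proj₂ such)) (2n-5≡1+2s s)

  N+d≡ : N + d ≡ triangle (3 + s)
  N+d≡ = T+d≡triangle (3 + s) d (≤-trans d≤2+s (n≤1+n _))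

  length≡2+s : length ps ≡ 2 + s
  length≡2+s = +-cancelˡ-≡ (h (3 + s) d ps) _ _ (begin-equality
    h (3 + s) d ps + length ps               ≡⟨ h+length≡j+length (3 + s) d M ps (s≤s (+-monoˡ-≤ s 2≤s)) increasing ps⊆[1,M] ⟩
    j (3 + s) d ps + length (π (3 + s) d)    ≡⟨ cong₂ _+_ (sym h≡j) length-π′ ⟩
    h (3 + s) d ps + (2 + s)                 ∎)
    where
    open DistinctPartition (proj₁ (proj₁ (proj₁ such)))
    M = suc (s + s)
    ps⊆[1,M] = subst (λ z → All (InRange z) ps) m≡M ps⊆[1,m]
    length-π′ : length (π (3 + s) d) ≡ 2 + s
    length-π′ = +-cancelʳ-≡ 1 _ _ (trans (length-π (3 + s) d 1≤d (≤-trans d≤2+s (n≤1+n _))) (+-comm 1 (2 + s)))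

  open LargestOdd s d m≡M length≡2+s N+d≡ public

  d≡4 : d ≡ 4
  d≡4 = ≤-antisym d≤4 (deficit≥4 s d N 1≤d N+d≡ maximal)

  open Tight d≡4 public

balanced-partition-unique : ∀ s d → 2 ≤ s → 1 ≤ d → d ≤ 2 + s → ∀ ps → Such (3 + s) d ps → h (3 + s) d ps ≡ j (3 + s) d ps →
  (d ≡ 4) × (2 ∣ 3 + s) × ((qs : List ℕ) → Such (3 + s) d qs → h (3 + s) d qs ≡ j (3 + s) d qs → qs ≡ ps)
balanced-partition-unique s d 2≤s 1≤d d≤2+s ps such h≡j =
  d≡4 , d≡4⇒2∣n s N (≤-trans (s≤s z≤n) 2≤s) (subst (λ z → N + z ≡ triangle (3 + s)) d≡4 N+d≡) maximal , unique
  where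
  open Balanced s d 2≤s 1≤d d≤2+s such h≡j
  unique : (qs : List ℕ) → Such (3 + s) d qs → h (3 + s) d qs ≡ j (3 + s) d qs → qs ≡ ps
  unique qs such′ h≡j′ = ↗-ext qs ps (DistinctPartition.increasing (proj₁ (proj₁ (proj₁ such′)))) increasing
      (Canonical⇒∈ ∘ Q.∈⇒Canonical) (Q.Canonical⇒∈ ∘ ∈⇒Canonical)
    where
    module Q = Balanced s d 2≤s 1≤d d≤2+s such′ h≡j′
    open DistinctPartition (proj₁ (proj₁ (proj₁ such)))

maximal-if-deficit≥4 : ∀ s d k N → N + d ≡ triangle (3 + s) → d + 2 * k ≡ 3 + s → 4 ≤ d → Maximal N (suc (s + s))
maximal-if-deficit≥4 s d k N N+d≡ d+2k≡ 4≤d qs (dp , ur) with largest qs ≤? suc (s + s)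
... | yes ≤M = ≤M
... | no  ≰M = ⊥-elim (largest≢2+2s s d k N+d≡ d+2k≡ 4≤d
                  (≤-antisym (largest≤2+2s s d N+d≡ (≤-trans (s≤s (s≤s (s≤s z≤n))) 4≤d)) (≰⇒> ≰M)))
  where open UnrefinablePartition dp ur

module TwoSwapsWitness (u v g : ℕ) (u≢v : u ≢ v) (u<g : u < g) (v<g : v < g) (u+v≤g : u + v ≤ g) where
  open TwoSwaps u v g u≢v u<g v<g public

  k n d N : ℕ
  k = u + v
  n = 3 + s
  d = n ∸ 2 * k
  N = T n d

  2k<s : 2 * k < s
  2k<s = s≤s (+-monoʳ-≤ k (≤-trans (≤-reflexive (+-identityʳ k)) u+v≤g))

  d+2k≡n : d + 2 * k ≡ n
  d+2k≡n = m∸n+n≡m (≤-trans (<⇒≤ 2k<s) (≤-trans (n≤1+n s) (≤-trans (n≤1+n _) (n≤1+n _))))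

  4≤d : 4 ≤ d
  4≤d = +-cancelʳ-≤ (2 * k) 4 d (≤-trans (s≤s (s≤s (s≤s 2k<s))) (≤-reflexive (sym d+2k≡n)))

  N+d≡ : N + d ≡ triangle n
  N+d≡ = T+d≡triangle n d (m∸n≤m n (2 * k))

  n≤M : n ≤ M
  n≤M = s≤s (+-monoˡ-≤ s (s≤s (≤-trans (≤-trans (s≤s z≤n) u<g) (m≤n+m g (u + v)))))

  h≡1+j : h n d edited ≡ suc (j n d edited)
  h≡1+j = +-cancelʳ-≡ (suc s) _ _ (begin-equality
    h n d edited + suc s              ≡⟨ cong (h n d edited +_) (sym length≡1+s) ⟩
    h n d edited + length edited      ≡⟨ h+length≡j+length n d M edited n≤M edited-↗ edited⊆[1,M] ⟩
    j n d edited + length (π n d)     ≡⟨ cong (j n d edited +_) length-π′ ⟩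
    j n d edited + (2 + s)            ≡⟨ +-suc (j n d edited) (suc s) ⟩
    suc (j n d edited) + suc s        ∎)
    where
    length-π′ : length (π n d) ≡ 2 + s
    length-π′ = +-cancelʳ-≡ 1 _ _ (trans (length-π n d (≤-trans (s≤s z≤n) 4≤d) (m∸n≤m n (2 * k))) (+-comm 1 (2 + s)))

  witness : Kept d → Such n d edited × (h n d edited ≡ suc (j n d edited))
  witness d-kept = ((∈U N d N+d≡ d+2k≡n , maximal′) , trans largest-edited (sym (2n-5≡1+2s s)) , d∈) , h≡1+j
    where
    maximal′ : ∀ qs → U N qs → largest qs ≤ largest edited
    maximal′ qs qs∈U = subst (largest qs ≤_) (sym largest-edited) (maximal-if-deficit≥4 s d k N N+d≡ d+2k≡n 4≤d qs qs∈U)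
    d∈ = ∈-edited⁺ (≤-trans (s≤s z≤n) 4≤d) (≤-trans (m∸n≤m n (2 * k)) n≤M) d-kept

Unbalanced : ℕ → ℕ → Set
Unbalanced n d = ∃ λ (ps : List ℕ) → Such n d ps × (h n d ps ≡ suc (j n d ps))

unbalanced-partition : ∀ s k → 8 ≤ s → 1 ≤ k → 2 * k < s → Unbalanced (3 + s) (3 + s ∸ 2 * k)
unbalanced-partition 1 _ (s≤s ()) _ _
unbalanced-partition 2 _ (s≤s (s≤s ())) _ _
unbalanced-partition (suc (suc g)) 1 8≤s _ _ =
  _ , TwoSwapsWitness.witness 1 0 g (λ ()) 1<g 0<g (≤-trans (s≤s z≤n) 1<g) (inj₂ (there (here (cong suc (sym (+-identityʳ _))))))
  where
  1<g : 1 < g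
  1<g = ≤-trans (s≤s (s≤s z≤n)) (≤-pred (≤-pred 8≤s))
  0<g = ≤-trans (s≤s z≤n) 1<g
unbalanced-partition (suc (suc (suc g))) 2 8≤s _ _ =
  _ , TwoSwapsWitness.witness 0 2 g (λ ()) 0<g 2<g (<⇒≤ 2<g) (inj₁ (n≤1+n _ , d∉))
  where
  2<g : 2 < g
  2<g = ≤-trans (s≤s (s≤s (s≤s z≤n))) (≤-pred (≤-pred (≤-pred 8≤s)))
  0<g = ≤-trans (s≤s z≤n) 2<g
  d∉ : 2 + g ∉ 3 + g ∷ 1 + g ∷ []
  d∉ (here d≡)         = <-irrefl d≡ (n<1+n _)
  d∉ (there (here d≡)) = <-irrefl (sym d≡) (n<1+n _)
unbalanced-partition s (suc (suc (suc k′))) _ _ 2k<s =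
  subst (λ z → Unbalanced (3 + z) (3 + z ∸ 2 * (3 + k′))) s′≡s (_ , W.witness (subst W.Kept (sym d≡) (inj₁ (d≤s′ , d∉))))
  where
  7+2k′≤s : 7 + (k′ + k′) ≤ s
  7+2k′≤s = ≤-trans (≤-reflexive (expand k′)) 2k<s
    where
    expand : ∀ k′ → 7 + (k′ + k′) ≡ suc (2 * (3 + k′))
    expand = solve-∀
  E = s ∸ (7 + (k′ + k′))
  g = 3 + k′ + E
  module W = TwoSwapsWitness 1 (2 + k′) g (λ ()) (s≤s (s≤s z≤n)) (s≤s (s≤s (s≤s (m≤m+n k′ E)))) (m≤m+n (3 + k′) E)
  s′≡s : W.s ≡ s
  s′≡s = trans (regroup k′ E) (m+[n∸m]≡n 7+2k′≤s)
    where
    regroup : ∀ k′ E → suc (1 + (2 + k′) + (3 + k′ + E)) ≡ 7 + (k′ + k′) + E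
    regroup = solve-∀
  d≡ : W.d ≡ 4 + E
  d≡ = trans (cong (_∸ 2 * (3 + k′)) (regroup k′ E)) (m+n∸m≡n (2 * (3 + k′)) (4 + E))
    where
    regroup : ∀ k′ E → 3 + suc (1 + (2 + k′) + (3 + k′ + E)) ≡ 2 * (3 + k′) + (4 + E)
    regroup = solve-∀
  d≤s′ : 4 + E ≤ W.s
  d≤s′ = s≤s (s≤s (s≤s (s≤s (≤-trans (m≤n+m E (3 + k′)) (m≤n+m (3 + k′ + E) k′)))))
  d∉ : 4 + E ∉ W.R₁ ∷ W.R₂ ∷ []
  d∉ (here d≡R₁) =
    <-irrefl d≡R₁ (≤-trans (s≤s (m≤n+m (4 + E) (k′ + k′))) (≤-trans (n≤1+n _) (≤-reflexive (regroup k′ E))))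
    where
    regroup : ∀ k′ E → suc (suc (k′ + k′ + (4 + E))) ≡ suc (2 + k′ + (3 + k′ + E))
    regroup = solve-∀
  d∉ (there (here d≡R₂)) = <-irrefl d≡R₂ (≤-trans (s≤s (m≤n+m (4 + E) k′)) (≤-reflexive (regroup k′ E)))
    where
    regroup : ∀ k′ E → suc (k′ + (4 + E)) ≡ suc (1 + (3 + k′ + E))
    regroup = solve-∀

proposition2p14 : (n : ℕ) → 11 ≤ n →
    ((d : ℕ) → 1 ≤ d → d ≤ n ∸ 1 → (ps : List ℕ) → Such n d ps → h n d ps ≡ j n d ps →
      (d ≡ 4) × (2 ∣ n) × ((qs : List ℕ) → Such n d qs → h n d qs ≡ j n d qs → qs ≡ ps))
    × ((k : ℕ) → 1 ≤ k → k ≤ (n ∸ 4) / 2 →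
      ∃ λ (ps : List ℕ) → Such n (n ∸ 2 * k) ps × (h n (n ∸ 2 * k) ps ≡ suc (j n (n ∸ 2 * k) ps)))
proposition2p14 0 ()
proposition2p14 1 (s≤s ())
proposition2p14 2 (s≤s (s≤s ()))
proposition2p14 3 (s≤s (s≤s (s≤s ())))
proposition2p14 (suc (suc (suc (suc s′)))) 11≤n =
  (λ d 1≤d d≤2+s ps → balanced-partition-unique s d (≤-trans (s≤s (s≤s z≤n)) 8≤s) 1≤d d≤2+s ps) ,
  (λ k 1≤k k≤s′/2 → unbalanced-partition s k 8≤s 1≤k (s≤s (2k≤s′ k k≤s′/2)))
  where
  s = suc s′
  8≤s : 8 ≤ s
  8≤s = ≤-pred (≤-pred (≤-pred 11≤n))
  2k≤s′ : ∀ k → k ≤ s′ / 2 → 2 * k ≤ s′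
  2k≤s′ k k≤s′/2 = ≤-trans (*-monoʳ-≤ 2 k≤s′/2) (≤-trans (≤-reflexive (*-comm 2 (s′ / 2))) (m/n*n≤m s′ 2))
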